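{- Let $s$ be the Fibonacci word of even order $2k>4$, $n=|s|$, and $\widehat{s}=s[0..n-2]$. Then $$\mathrm{BWT}(\widehat{s})={\tt b}^{k-1}{\tt a}{\tt b}^{F_{2k-3}-k+1}{\tt a}{\tt b}^{F_{2k-5}}\cdots{\tt b}^{F_5}{\tt a}{\tt b}^{F_3}{\tt a}{\tt b}\,{\tt a}^{F_{2k-1}-k+1},$$ i.e. $\mathrm{BWT}(\widehat{s})={\tt b}^{k-1}{\tt a}{\tt b}^{F_{2k-3}-k+1}\left(\prod_{i=3}^{k}{\tt a}{\tt b}^{F_{2k-2i+1}}\right){\tt a}^{F_{2k-1}-k+1}$. Consequently $\mathrm{BWT}(\widehat{s})$ has $2k$ runs.
   Context: Alphabet $\{{\tt a},{\tt b}\}$ with ${\tt a}<{\tt b}$; words indexed from $0$. $\mathrm{BWT}(w)$: sort the conjugates $w[i..n-1]w[0..i-1]$ of $w$ lexicographically and concatenate their last characters. A run is a maximal equal-letter factor. Fibonacci words: $s_0={\tt b}$, $s_1={\tt a}$, $s_{i+1}=s_is_{i-1}$ ($i\ge1$), $s_i$ has order $i$. $F_i=|s_i|$ ($F_0=F_1=1$, $F_{i+1}=F_i+F_{i-1}$). $\prod$ denotes concatenation in increasing order of index. -}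

module Defs where

open import Data.Nat using (ℕ; zero; suc; _+_; _*_; _∸_)
open import Data.List using (List; []; _∷_; _++_; length; take; drop; map; concatMap; upTo; replicate)
open import Data.Bool using (Bool; true; false; if_then_else_)

data Letter : Set where
  a b : Letter

Word : Set
Word = List Letter

_<ᴸ_ : Letter → Letter → Bool
a <ᴸ b = true
_ <ᴸ _ = false

_==ᴸ_ : Letter → Letter → Bool
a ==ᴸ a = true
b ==ᴸ b = true
_ ==ᴸ _ = false

_≤ˡᵉˣ_ : Word → Word → Bool
[] ≤ˡᵉˣ _ = true
(_ ∷ _) ≤ˡᵉˣ [] = false
(x ∷ u) ≤ˡᵉˣ (y ∷ v) = if x <ᴸ y then true else (if x ==ᴸ y then u ≤ˡᵉˣ v else false)

insert : Word → List Word → List Word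
insert u [] = u ∷ []
insert u (v ∷ vs) = if u ≤ˡᵉˣ v then u ∷ v ∷ vs else v ∷ insert u vs

sortWords : List Word → List Word
sortWords [] = []
sortWords (u ∷ us) = insert u (sortWords us)

conj : Word → ℕ → Word
conj w i = drop i w ++ take i w

conjugates : Word → List Word
conjugates w = map (conj w) (upTo (length w))

-- last letter of a word (default a on the empty word; never used since conjugates of
-- a nonempty word are nonempty)
lastL : Word → Letter
lastL [] = a
lastL (x ∷ []) = x
lastL (_ ∷ y ∷ u) = lastL (y ∷ u)

BWT : Word → Word
BWT w = map lastL (sortWords (conjugates w))

runs : Word → ℕ
runs [] = 0
runs (_ ∷ []) = 1
runs (x ∷ y ∷ u) = (if x ==ᴸ y then 0 else 1) + runs (y ∷ u)

fibWord : ℕ → Word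
fibWord 0 = b ∷ []
fibWord 1 = a ∷ []
fibWord (suc (suc i)) = fibWord (suc i) ++ fibWord i

F : ℕ → ℕ
F 0 = 1
F 1 = 1
F (suc (suc i)) = F (suc i) + F i

_^ʷ_ : Letter → ℕ → Word
x ^ʷ m = replicate m x

hat : Word → Word
hat s = take (length s ∸ 1) s

middle : ℕ → Word
middle k = concatMap (λ i → a ∷ (b ^ʷ F ((2 * k ∸ 2 * i) + 1))) (map (3 +_) (upTo (k ∸ 2)))

expectedBWT : ℕ → Word
expectedBWT k =
  (b ^ʷ (k ∸ 1)) ++ (a ∷ (b ^ʷ (F (2 * k ∸ 3) ∸ (k ∸ 1))))
    ++ middle k ++ (a ^ʷ (F (2 * k ∸ 1) ∸ (k ∸ 1)))

{-# OPTIONS --safe #-}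
-- A word L with A letters a determines its standard permutation ψ, which sends x to the
-- position in L of the occurrence, of the same rank, of the letter at position x of
-- a^A b^(|L| - A).  If ψ is a single cycle, the word w read along it (a at the points x < A,
-- b elsewhere) satisfies BWT w = L: the conjugates of w are read from the points 0, …, |L| - 1,
-- and these readings are already sorted because ψ is increasing on [0, A) and on [A, |L|).
-- So it suffices to show that the standard permutation of the claimed BWT (for k = n + 2) is a
-- single cycle along which one reads a rotation of ŝ.  This goes by induction on n: the cycle of
-- level n + 1 arises from that of level n by replacing each step from a point read as a by three
-- steps read a b a, each step from a point read as b by two steps read a b, and one step by four
-- steps read a b a a.  As a ↦ a b a, b ↦ a b is the square φ² of the Fibonacci morphism and
-- s₂ₖ₊₂ = φ²(s₂ₖ), the word read along the cycle passes from order 2k to order 2k + 2.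

module Submission where

open import Defs
open import Data.Bool using (true; false; if_then_else_)
open import Data.Empty using (⊥; ⊥-elim)
open import Data.Fin as Fin using (Fin; toℕ; fromℕ<; punchOut)
open import Data.Fin.Properties using (toℕ<n; toℕ-fromℕ<; punchOut-injective; pigeonhole)
open import Data.List using (List; []; _∷_; _++_; length; map; upTo; applyUpTo; take; drop; concat; concatMap)
open import Data.List.Membership.Propositional using (_∈_)
open import Data.List.Membership.Propositional.Properties using (∈-applyUpTo⁺; ∈-applyUpTo⁻; ∈-upTo⁺; ∈-upTo⁻)
open import Data.List.Membership.Propositional.Properties.WithK using (unique∧set⇒bag)
open import Data.List.Properties using (length-++; ++-assoc; map-applyUpTo; map-upTo; map-cong-local; map-∘; concatMap-++; concatMap-map; concatMap-cong)
open import Data.List.Relation.Binary.BagAndSetEquality using (∼bag⇒↭)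
open import Data.List.Relation.Binary.Permutation.Propositional using (_↭_; ↭-refl; ↭-trans; prep; swap; ↭⇒↭ₛ)
import Data.List.Relation.Binary.Permutation.Propositional.Properties as ↭
open import Data.List.Relation.Binary.Pointwise using (Pointwise-≡⇒≡)
open import Data.List.Relation.Unary.All as All using (All; []; _∷_)
open import Data.List.Relation.Unary.All.Properties using (all-upTo)
open import Data.List.Relation.Unary.Linked using (Linked; []; [-]; _∷_)
import Data.List.Relation.Unary.Linked.Properties as Linked
import Data.List.Relation.Unary.Sorted.TotalOrder.Properties as SortedProperties
open import Data.List.Relation.Unary.Unique.Propositional.Properties using (applyUpTo⁺₁; upTo⁺)
open import Data.Nat using (ℕ; zero; suc; _+_; _*_; _∸_; _<_; _≤_; z≤n; s≤s; _<ᵇ_; _≡ᵇ_)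
open import Data.Nat.GeneralisedArithmetic using (iterate)
open import Data.Nat.Properties
open import Data.Nat.Tactic.RingSolver using (solve-∀)
open import Data.Product using (_×_; _,_; proj₁; proj₂; ∃; ∃₂)
open import Data.Sum using (_⊎_; inj₁; inj₂)
open import Function using (_∘_)
open import Function.Bundles using (mk⇔)
open import Relation.Binary.Bundles using (TotalOrder)
open import Relation.Binary.Definitions using (tri<; tri≈; tri>)
open import Relation.Binary.PropositionalEquality
open import Relation.Nullary using (yes; no)
open import Algebra.Properties.CommutativeSemigroup +-commutativeSemigroup using () renaming (xy∙z≈xz∙y to +-right-comm)

-- Lexicographic order and insertion sort

_≼_ : Word → Word → Set
u ≼ v = u ≤ˡᵉˣ v ≡ true

≼-refl : ∀ u → u ≼ u
≼-refl [] = refl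
≼-refl (a ∷ u) = ≼-refl u
≼-refl (b ∷ u) = ≼-refl u

≼-antisym : ∀ u v → u ≼ v → v ≼ u → u ≡ v
≼-antisym [] [] _ _ = refl
≼-antisym (a ∷ u) (a ∷ v) p q = cong (a ∷_) (≼-antisym u v p q)
≼-antisym (b ∷ u) (b ∷ v) p q = cong (b ∷_) (≼-antisym u v p q)
≼-antisym [] (_ ∷ _) _ ()
≼-antisym (_ ∷ _) [] ()
≼-antisym (a ∷ u) (b ∷ v) _ ()
≼-antisym (b ∷ u) (a ∷ v) ()

≼-trans : ∀ u v w → u ≼ v → v ≼ w → u ≼ w
≼-trans [] _ _ _ _ = refl
≼-trans (a ∷ u) (a ∷ v) (a ∷ w) p q = ≼-trans u v w p q
≼-trans (b ∷ u) (b ∷ v) (b ∷ w) p q = ≼-trans u v w p q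
≼-trans (a ∷ u) (a ∷ v) (b ∷ w) _ _ = refl
≼-trans (a ∷ u) (b ∷ v) (b ∷ w) _ _ = refl
≼-trans (_ ∷ _) [] _ ()
≼-trans (_ ∷ _) (_ ∷ _) [] _ ()
≼-trans (a ∷ u) (b ∷ v) (a ∷ w) _ ()
≼-trans (b ∷ u) (a ∷ v) _ ()
≼-trans (b ∷ u) (b ∷ v) (a ∷ w) _ ()

≼-total : ∀ u v → u ≼ v ⊎ v ≼ u
≼-total [] v = inj₁ refl
≼-total (x ∷ u) [] = inj₂ refl
≼-total (a ∷ u) (a ∷ v) = ≼-total u v
≼-total (a ∷ u) (b ∷ v) = inj₁ refl
≼-total (b ∷ u) (a ∷ v) = inj₂ refl
≼-total (b ∷ u) (b ∷ v) = ≼-total u v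

≼-totalOrder : TotalOrder _ _ _
≼-totalOrder = record
  { isTotalOrder = record
    { isPartialOrder = record
      { isPreorder = record
        { isEquivalence = isEquivalence
        ; reflexive = λ { {u} refl → ≼-refl u }
        ; trans = λ {u} {v} {w} → ≼-trans u v w
        }
      ; antisym = λ {u} {v} → ≼-antisym u v
      }
    ; total = ≼-total
    }
  }

≰⇒≽ : ∀ u v → u ≤ˡᵉˣ v ≡ false → v ≼ u
≰⇒≽ u v u≰v with ≼-total u v
... | inj₁ u≼v with () ← trans (sym u≼v) u≰v
... | inj₂ v≼u = v≼u

Sorted : List Word → Set
Sorted = Linked _≼_

insert-sorted-below : ∀ v u vs → v ≼ u → Sorted (v ∷ vs) → Sorted (v ∷ insert u vs)
insert-sorted-below v u [] v≼u _ = v≼u ∷ [-]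
insert-sorted-below v u (x ∷ vs) v≼u (v≼x ∷ sorted) with u ≤ˡᵉˣ x in u≤x
... | true = v≼u ∷ u≤x ∷ sorted
... | false = v≼x ∷ insert-sorted-below x u vs (≰⇒≽ u x u≤x) sorted

insert-sorted : ∀ u vs → Sorted vs → Sorted (insert u vs)
insert-sorted u [] _ = [-]
insert-sorted u (v ∷ vs) sorted with u ≤ˡᵉˣ v in u≤v
... | true = u≤v ∷ sorted
... | false = insert-sorted-below v u vs (≰⇒≽ u v u≤v) sorted

sortWords-sorted : ∀ us → Sorted (sortWords us)
sortWords-sorted [] = []
sortWords-sorted (u ∷ us) = insert-sorted u (sortWords us) (sortWords-sorted us)

insert-↭ : ∀ u vs → insert u vs ↭ u ∷ vs
insert-↭ u [] = ↭-refl
insert-↭ u (v ∷ vs) with u ≤ˡᵉˣ v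
... | true = ↭-refl
... | false = ↭-trans (prep v (insert-↭ u vs)) (swap v u ↭-refl)

sortWords-↭ : ∀ us → sortWords us ↭ us
sortWords-↭ [] = ↭-refl
sortWords-↭ (u ∷ us) = ↭-trans (insert-↭ u (sortWords us)) (prep u (sortWords-↭ us))

sortWords-unique : ∀ us vs → Sorted vs → us ↭ vs → sortWords us ≡ vs
sortWords-unique us vs sorted us↭vs = Pointwise-≡⇒≡
  (SortedProperties.↗↭↗⇒≋ ≼-totalOrder (sortWords-sorted us) sorted (↭⇒↭ₛ (↭-trans (sortWords-↭ us) us↭vs)))

-- Orbits and their itineraries

m≤n<m+o⇒n∸m<o : ∀ {m n o} → m ≤ n → n < m + o → n ∸ m < o
m≤n<m+o⇒n∸m<o {m} {n} {o} m≤n n<m+o = +-cancelˡ-< m (n ∸ m) o (subst (_< m + o) (sym (m+[n∸m]≡n m≤n)) n<m+o)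

take-length-++ : ∀ {X : Set} (u v : List X) → take (length u) (u ++ v) ≡ u
take-length-++ [] v = refl
take-length-++ (x ∷ u) v = cong (x ∷_) (take-length-++ u v)

drop-length-++ : ∀ {X : Set} (u v : List X) → drop (length u) (u ++ v) ≡ v
drop-length-++ [] v = refl
drop-length-++ (x ∷ u) v = drop-length-++ u v

conj-++ : ∀ u v {r} → length u ≡ r → conj (u ++ v) r ≡ v ++ u
conj-++ u v refl = cong₂ _++_ (drop-length-++ u v) (take-length-++ u v)

iterate-+ : ∀ (f : ℕ → ℕ) x m n → iterate f x (m + n) ≡ iterate f (iterate f x m) n
iterate-+ f x zero n = refl
iterate-+ f x (suc m) n = iterate-+ f (f x) m n

iterate-suc : ∀ (f : ℕ → ℕ) x n → iterate f x (suc n) ≡ f (iterate f x n)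
iterate-suc f x n = trans (cong (iterate f x) (+-comm 1 n)) (iterate-+ f x n 1)

iterate-comm : ∀ (f : ℕ → ℕ) x m n → iterate f (iterate f x m) n ≡ iterate f (iterate f x n) m
iterate-comm f x m n =
  trans (sym (iterate-+ f x m n)) (trans (cong (iterate f x) (+-comm m n)) (iterate-+ f x n m))

Closed : (ℕ → ℕ) → ℕ → Set
Closed f M = ∀ {x} → x < M → f x < M

InjectiveOn : (ℕ → ℕ) → ℕ → Set
InjectiveOn f M = ∀ {x y} → x < M → y < M → f x ≡ f y → x ≡ y

ExactPeriod : (ℕ → ℕ) → ℕ → ℕ → Set
ExactPeriod f M x = iterate f x M ≡ x × (∀ t → 0 < t → t < M → iterate f x t ≢ x)

iterate-closed : ∀ {f M} → Closed f M → ∀ n → Closed (λ x → iterate f x n) M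
iterate-closed closed zero x<M = x<M
iterate-closed closed (suc n) x<M = iterate-closed closed n (closed x<M)

iterate-injectiveOn : ∀ {f M} → Closed f M → InjectiveOn f M → ∀ n → InjectiveOn (λ x → iterate f x n) M
iterate-injectiveOn closed inj zero x<M y<M eq = eq
iterate-injectiveOn closed inj (suc n) x<M y<M eq =
  inj x<M y<M (iterate-injectiveOn closed inj n (closed x<M) (closed y<M) eq)

exactPeriod-iterate : ∀ {f M x} → Closed f M → InjectiveOn f M → x < M →
  ExactPeriod f M x → ∀ r → ExactPeriod f M (iterate f x r)
exactPeriod-iterate {f} {M} {x} closed inj x<M (back , noReturn) r =
    trans (iterate-comm f x r M) (cong (λ y → iterate f y r) back)
  , λ t t>0 t<M eq → noReturn t t>0 t<M
      (iterate-injectiveOn closed inj r (iterate-closed closed t x<M) x<M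
        (trans (iterate-comm f x t r) eq))

injectiveOn⇒surjectiveOn : ∀ {f M} → Closed f M → InjectiveOn f M →
  ∀ {x} → x < M → ∃ λ j → j < M × f j ≡ x
injectiveOn⇒surjectiveOn {M = zero} _ _ ()
injectiveOn⇒surjectiveOn {f} {suc m} closed inj {x} x<M with anyUpTo? (λ j → f j ≟ x) (suc m)
... | yes hit = hit
... | no miss = ⊥-elim (collision (pigeonhole (n<1+n m) squeeze))
  where
  image : Fin (suc m) → Fin (suc m)
  image i = fromℕ< (closed (toℕ<n i))
  toℕ-image : ∀ i → toℕ (image i) ≡ f (toℕ i)
  toℕ-image i = toℕ-fromℕ< (closed (toℕ<n i))
  x∉image : ∀ i → fromℕ< x<M ≢ image i
  x∉image i eq = miss (toℕ i , toℕ<n i , trans (sym (toℕ-image i)) (trans (cong toℕ (sym eq)) (toℕ-fromℕ< x<M)))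
  squeeze : Fin (suc m) → Fin m
  squeeze i = punchOut (x∉image i)
  collision : (∃₂ λ i j → i Fin.< j × squeeze i ≡ squeeze j) → ⊥
  collision (i , j , i<j , eq) = <-irrefl (inj (toℕ<n i) (toℕ<n j) f-eq) i<j
    where
    f-eq : f (toℕ i) ≡ f (toℕ j)
    f-eq = trans (sym (toℕ-image i))
             (trans (cong toℕ (punchOut-injective (x∉image i) (x∉image j) eq)) (toℕ-image j))

module Orbit {f : ℕ → ℕ} {M x₀ : ℕ} (closed : Closed f M) (injective : InjectiveOn f M)
             (x₀<M : x₀ < M) (period : ExactPeriod f M x₀) where

  orbit : ℕ → ℕ
  orbit = iterate f x₀

  orbit-< : ∀ j → orbit j < M
  orbit-< j = iterate-closed closed j x₀<M

  orbit-distinct : ∀ {i j} → i < j → j < M → orbit i ≢ orbit j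
  orbit-distinct {i} {j} i<j j<M eq = proj₂ period d (m<n⇒0<n∸m i<j) d<M
      (sym (iterate-injectiveOn closed injective i x₀<M (orbit-< d) (trans eq orbit-j)))
    where
    d : ℕ
    d = j ∸ i
    d<M : d < M
    d<M = ≤-<-trans (m∸n≤m j i) j<M
    orbit-j : orbit j ≡ iterate f (orbit d) i
    orbit-j = trans (cong orbit (sym (m+[n∸m]≡n (<⇒≤ i<j))))
                (trans (iterate-+ f x₀ i d) (iterate-comm f x₀ i d))

  orbit-surjective : ∀ {x} → x < M → ∃ λ j → j < M × orbit j ≡ x
  orbit-surjective = injectiveOn⇒surjectiveOn (λ {j} _ → orbit-< j) orbit-injective
    where
    orbit-injective : InjectiveOn orbit M
    orbit-injective {i} {j} i<M j<M eq with <-cmp i j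
    ... | tri< i<j _ _ = ⊥-elim (orbit-distinct i<j j<M eq)
    ... | tri≈ _ i≡j _ = i≡j
    ... | tri> _ _ j<i = ⊥-elim (orbit-distinct j<i i<M (sym eq))

  orbit-↭ : applyUpTo orbit M ↭ upTo M
  orbit-↭ = ∼bag⇒↭ (unique∧set⇒bag (applyUpTo⁺₁ orbit M orbit-distinct) (upTo⁺ M) (mk⇔ into onto))
    where
    into : ∀ {x} → x ∈ applyUpTo orbit M → x ∈ upTo M
    into x∈ with j , _ , refl ← ∈-applyUpTo⁻ orbit x∈ = ∈-upTo⁺ (orbit-< j)
    onto : ∀ {x} → x ∈ upTo M → x ∈ applyUpTo orbit M
    onto x∈ with j , j<M , refl ← orbit-surjective (∈-upTo⁻ x∈) = ∈-applyUpTo⁺ orbit j<M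

  iterate-period : ∀ j → iterate f (orbit j) M ≡ orbit j
  iterate-period j = trans (iterate-comm f x₀ j M) (cong (λ y → iterate f y j) (proj₁ period))

if-<ᵇ-yes : ∀ {X : Set} {x y} {p q : X} → x < y → (if x <ᵇ y then p else q) ≡ p
if-<ᵇ-yes {x = x} {y} x<y with x <ᵇ y | <⇒<ᵇ x<y
... | true | _ = refl

if-<ᵇ-no : ∀ {X : Set} {x y} {p q : X} → y ≤ x → (if x <ᵇ y then p else q) ≡ q
if-<ᵇ-no {x = x} {y} y≤x with x <ᵇ y | <ᵇ⇒< x y
... | false | _ = refl
... | true | x<y = ⊥-elim (<⇒≱ (x<y _) y≤x)

if-≡ᵇ-yes : ∀ {X : Set} {x y} {p q : X} → x ≡ y → (if x ≡ᵇ y then p else q) ≡ p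
if-≡ᵇ-yes {x = x} {y} x≡y with x ≡ᵇ y | ≡⇒≡ᵇ x y x≡y
... | true | _ = refl

if-≡ᵇ-no : ∀ {X : Set} {x y} {p q : X} → x ≢ y → (if x ≡ᵇ y then p else q) ≡ q
if-≡ᵇ-no {x = x} {y} x≢y with x ≡ᵇ y | ≡ᵇ⇒≡ x y
... | false | _ = refl
... | true | x≡y = ⊥-elim (x≢y (x≡y _))

label : ℕ → ℕ → Letter
label A x = if x <ᵇ A then a else b

label-< : ∀ {A x} → x < A → label A x ≡ a
label-< = if-<ᵇ-yes

label-≥ : ∀ {A x} → A ≤ x → label A x ≡ b
label-≥ = if-<ᵇ-no

itinerary : (ℕ → ℕ) → ℕ → ℕ → ℕ → Word
itinerary f A zero x = []
itinerary f A (suc n) x = label A x ∷ itinerary f A n (f x)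

length-itinerary : ∀ f A n x → length (itinerary f A n x) ≡ n
length-itinerary f A zero x = refl
length-itinerary f A (suc n) x = cong suc (length-itinerary f A n (f x))

itinerary-+ : ∀ f A m n x → itinerary f A (m + n) x ≡ itinerary f A m x ++ itinerary f A n (iterate f x m)
itinerary-+ f A zero n x = refl
itinerary-+ f A (suc m) n x = cong (label A x ∷_) (itinerary-+ f A m n (f x))

lastL-itinerary : ∀ f A n x → lastL (itinerary f A (suc n) x) ≡ label A (iterate f x n)
lastL-itinerary f A zero x = refl
lastL-itinerary f A (suc n) x = lastL-itinerary f A n (f x)

itinerary-rotate : ∀ f A N x r → iterate f x N ≡ x → r ≤ N →
  itinerary f A N (iterate f x r) ≡ conj (itinerary f A N x) r
itinerary-rotate f A N x r back r≤N = begin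
    itinerary f A N y
  ≡⟨ cong (λ k → itinerary f A k y) (trans N≡r+d (+-comm r d)) ⟩
    itinerary f A (d + r) y
  ≡⟨ itinerary-+ f A d r y ⟩
    itinerary f A d y ++ itinerary f A r (iterate f y d)
  ≡⟨ cong (λ z → itinerary f A d y ++ itinerary f A r z) y↦x ⟩
    itinerary f A d y ++ itinerary f A r x
  ≡⟨ sym (conj-++ (itinerary f A r x) _ (length-itinerary f A r x)) ⟩
    conj (itinerary f A r x ++ itinerary f A d y) r
  ≡⟨ cong (λ w → conj w r) (sym (trans (cong (λ k → itinerary f A k x) N≡r+d) (itinerary-+ f A r d x))) ⟩
    conj (itinerary f A N x) r
  ∎
  where
  open ≡-Reasoning
  y d : ℕ
  y = iterate f x r
  d = N ∸ r
  N≡r+d : N ≡ r + d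
  N≡r+d = sym (m+[n∸m]≡n r≤N)
  y↦x : iterate f y d ≡ x
  y↦x = trans (sym (iterate-+ f x r d)) (trans (cong (iterate f x) (sym N≡r+d)) back)

data Path (f : ℕ → ℕ) : ℕ → List ℕ → ℕ → Set where
  [_] : ∀ {x z} → f x ≡ z → Path f x [] z
  _∷_ : ∀ {x p ps z} → f x ≡ p → Path f p ps z → Path f x (p ∷ ps) z

path-iterate : ∀ {f x ps z} → Path f x ps z → iterate f x (suc (length ps)) ≡ z
path-iterate [ fx≡z ] = fx≡z
path-iterate {f} {ps = _ ∷ ps} (fx≡p ∷ path) = trans (cong (λ u → iterate f u (suc (length ps))) fx≡p) (path-iterate path)

path-itinerary : ∀ {f x ps z} A → Path f x ps z → itinerary f A (suc (length ps)) x ≡ label A x ∷ map (label A) ps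
path-itinerary A [ _ ] = refl
path-itinerary {f} {x} {ps = _ ∷ ps} A (fx≡p ∷ path) =
  cong (label A x ∷_) (trans (cong (itinerary f A (suc (length ps))) fx≡p) (path-itinerary A path))

path-inner : ∀ {f x ps z} {P : ℕ → Set} → Path f x ps z → All P ps →
  ∀ t → 0 < t → t < suc (length ps) → P (iterate f x t)
path-inner [ _ ] [] (suc t) _ (s≤s ())
path-inner {P = P} (fx≡p ∷ path) (Pp ∷ _) (suc zero) _ _ = subst P (sym fx≡p) Pp
path-inner {f} {P = P} (fx≡p ∷ path) (_ ∷ Pps) (suc (suc t)) _ (s≤s t<) =
  subst (λ u → P (iterate f u (suc t))) (sym fx≡p) (path-inner path Pps (suc t) (s≤s z≤n) t<)

-- The standard permutation of a word

count : Letter → Word → ℕ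
count x [] = 0
count a (a ∷ w) = suc (count a w)
count a (b ∷ w) = count a w
count b (a ∷ w) = count b w
count b (b ∷ w) = suc (count b w)

-- position of the i-th (from 0) occurrence of x in w; 0 if there is none
select : Letter → Word → ℕ → ℕ
select x [] i = 0
select a (a ∷ w) zero = 0
select a (a ∷ w) (suc i) = suc (select a w i)
select a (b ∷ w) i = suc (select a w i)
select b (b ∷ w) zero = 0
select b (b ∷ w) (suc i) = suc (select b w i)
select b (a ∷ w) i = suc (select b w i)

at : Word → ℕ → Letter
at [] i = a
at (x ∷ w) zero = x
at (x ∷ w) (suc i) = at w i

count-++ : ∀ x u v → count x (u ++ v) ≡ count x u + count x v
count-++ x [] v = refl
count-++ a (a ∷ u) v = cong suc (count-++ a u v)
count-++ a (b ∷ u) v = count-++ a u v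
count-++ b (a ∷ u) v = count-++ b u v
count-++ b (b ∷ u) v = cong suc (count-++ b u v)

length≡count-a+count-b : ∀ w → length w ≡ count a w + count b w
length≡count-a+count-b [] = refl
length≡count-a+count-b (a ∷ w) = cong suc (length≡count-a+count-b w)
length≡count-a+count-b (b ∷ w) = trans (cong suc (length≡count-a+count-b w)) (sym (+-suc _ _))

select-<-length : ∀ x w i → i < count x w → select x w i < length w
select-<-length a (a ∷ w) zero _ = s≤s z≤n
select-<-length a (a ∷ w) (suc i) (s≤s i<c) = s≤s (select-<-length a w i i<c)
select-<-length a (b ∷ w) i i<c = s≤s (select-<-length a w i i<c)
select-<-length b (b ∷ w) zero _ = s≤s z≤n
select-<-length b (b ∷ w) (suc i) (s≤s i<c) = s≤s (select-<-length b w i i<c)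
select-<-length b (a ∷ w) i i<c = s≤s (select-<-length b w i i<c)

select-monotone : ∀ x w {i j} → i < j → j < count x w → select x w i < select x w j
select-monotone a (a ∷ w) {zero} {suc j} _ _ = s≤s z≤n
select-monotone a (a ∷ w) {suc i} {suc j} (s≤s i<j) (s≤s j<c) = s≤s (select-monotone a w i<j j<c)
select-monotone a (b ∷ w) i<j j<c = s≤s (select-monotone a w i<j j<c)
select-monotone b (b ∷ w) {zero} {suc j} _ _ = s≤s z≤n
select-monotone b (b ∷ w) {suc i} {suc j} (s≤s i<j) (s≤s j<c) = s≤s (select-monotone b w i<j j<c)
select-monotone b (a ∷ w) i<j j<c = s≤s (select-monotone b w i<j j<c)

at-select : ∀ x w i → i < count x w → at w (select x w i) ≡ x
at-select a (a ∷ w) zero _ = refl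
at-select a (a ∷ w) (suc i) (s≤s i<c) = at-select a w i i<c
at-select a (b ∷ w) i i<c = at-select a w i i<c
at-select b (b ∷ w) zero _ = refl
at-select b (b ∷ w) (suc i) (s≤s i<c) = at-select b w i i<c
at-select b (a ∷ w) i i<c = at-select b w i i<c

select-++ˡ : ∀ x u v i → i < count x u → select x (u ++ v) i ≡ select x u i
select-++ˡ a (a ∷ u) v zero _ = refl
select-++ˡ a (a ∷ u) v (suc i) (s≤s i<c) = cong suc (select-++ˡ a u v i i<c)
select-++ˡ a (b ∷ u) v i i<c = cong suc (select-++ˡ a u v i i<c)
select-++ˡ b (b ∷ u) v zero _ = refl
select-++ˡ b (b ∷ u) v (suc i) (s≤s i<c) = cong suc (select-++ˡ b u v i i<c)
select-++ˡ b (a ∷ u) v i i<c = cong suc (select-++ˡ b u v i i<c)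

select-++ʳ : ∀ x u v i → select x (u ++ v) (count x u + i) ≡ length u + select x v i
select-++ʳ x [] v i = refl
select-++ʳ a (a ∷ u) v i = cong suc (select-++ʳ a u v i)
select-++ʳ a (b ∷ u) v i = cong suc (select-++ʳ a u v i)
select-++ʳ b (a ∷ u) v i = cong suc (select-++ʳ b u v i)
select-++ʳ b (b ∷ u) v i = cong suc (select-++ʳ b u v i)

-- The standard permutation of L, for A = count a L.  When L = BWT w, it sends the row of the
-- conjugate c ∷ v of w in the sorted list of conjugates to the row of v ++ c ∷ [].
ψ : Word → ℕ → ℕ → ℕ
ψ L A x = if x <ᵇ A then select a L x else select b L (x ∸ A)

ψ-< : ∀ L {A x} → x < A → ψ L A x ≡ select a L x
ψ-< L = if-<ᵇ-yes

ψ-≥ : ∀ L {A x} → A ≤ x → ψ L A x ≡ select b L (x ∸ A)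
ψ-≥ L = if-<ᵇ-no

ψ-+ : ∀ L A u → ψ L A (A + u) ≡ select b L u
ψ-+ L A u = trans (ψ-≥ L (m≤m+n A u)) (cong (select b L) (m+n∸m≡n A u))

applyUpTo-at : ∀ w → applyUpTo (at w) (length w) ≡ w
applyUpTo-at [] = refl
applyUpTo-at (x ∷ w) = cong (x ∷_) (applyUpTo-at w)

module StandardPermutation (L : Word) {A M : ℕ} (count-a : count a L ≡ A) (length-L : length L ≡ M) where

  a-rank : ∀ {x} → x < A → x < count a L
  a-rank = subst (_ <_) (sym count-a)

  b-rank : ∀ {x} → A ≤ x → x < M → x ∸ A < count b L
  b-rank {x} A≤x x<M = m≤n<m+o⇒n∸m<o A≤x (subst (x <_) (sym A+count-b) x<M)
    where
    A+count-b : A + count b L ≡ M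
    A+count-b = trans (cong (_+ count b L) (sym count-a)) (trans (sym (length≡count-a+count-b L)) length-L)

  ψ-closed : Closed (ψ L A) M
  ψ-closed {x} x<M with x <? A
  ... | yes x<A = subst₂ _<_ (sym (ψ-< L x<A)) length-L (select-<-length a L x (a-rank x<A))
  ... | no x≮A = subst₂ _<_ (sym (ψ-≥ L (≮⇒≥ x≮A))) length-L (select-<-length b L _ (b-rank (≮⇒≥ x≮A) x<M))

  at-ψ : ∀ {y} → y < M → at L (ψ L A y) ≡ label A y
  at-ψ {y} y<M with y <? A
  ... | yes y<A = trans (cong (at L) (ψ-< L y<A)) (trans (at-select a L y (a-rank y<A)) (sym (label-< y<A)))
  ... | no y≮A = trans (cong (at L) (ψ-≥ L A≤y)) (trans (at-select b L _ (b-rank A≤y y<M)) (sym (label-≥ A≤y)))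
    where A≤y = ≮⇒≥ y≮A

  ψ-monotone : ∀ {x y} → x < y → y < M → label A x ≡ label A y → ψ L A x < ψ L A y
  ψ-monotone {x} {y} x<y y<M same with y <? A | x <? A
  ... | yes y<A | _ = subst₂ _<_ (sym (ψ-< L (<-trans x<y y<A))) (sym (ψ-< L y<A))
                        (select-monotone a L x<y (a-rank y<A))
  ... | no y≮A | yes x<A with () ← trans (sym (label-< x<A)) (trans same (label-≥ (≮⇒≥ y≮A)))
  ... | no y≮A | no x≮A = subst₂ _<_ (sym (ψ-≥ L A≤x)) (sym (ψ-≥ L A≤y))
                            (select-monotone b L (∸-monoˡ-< x<y A≤x) (b-rank A≤y y<M))
    where
    A≤x : A ≤ x
    A≤x = ≮⇒≥ x≮A
    A≤y : A ≤ y
    A≤y = ≮⇒≥ y≮A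

  ψ-injective : InjectiveOn (ψ L A) M
  ψ-injective {x} {y} x<M y<M eq with <-cmp x y
  ... | tri< x<y _ _ = ⊥-elim (<-irrefl eq (ψ-monotone x<y y<M same))
    where
    same : label A x ≡ label A y
    same = trans (sym (at-ψ x<M)) (trans (cong (at L) eq) (at-ψ y<M))
  ... | tri≈ _ x≡y _ = x≡y
  ... | tri> _ _ y<x = ⊥-elim (<-irrefl (sym eq) (ψ-monotone y<x x<M same))
    where
    same : label A y ≡ label A x
    same = trans (sym (at-ψ y<M)) (trans (cong (at L) (sym eq)) (at-ψ x<M))

  itinerary-monotone : ∀ n {x y} → x ≤ y → y < M → itinerary (ψ L A) A n x ≼ itinerary (ψ L A) A n y
  itinerary-monotone zero _ _ = refl
  itinerary-monotone (suc n) {x} {y} x≤y y<M with m≤n⇒m<n∨m≡n x≤y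
  ... | inj₂ refl = ≼-refl (itinerary (ψ L A) A (suc n) x)
  ... | inj₁ x<y with x <? A | y <? A
  ...   | yes x<A | yes y<A rewrite label-< x<A | label-< y<A =
            itinerary-monotone n (<⇒≤ (ψ-monotone x<y y<M (trans (label-< x<A) (sym (label-< y<A))))) (ψ-closed y<M)
  ...   | yes x<A | no y≮A rewrite label-< x<A | label-≥ (≮⇒≥ y≮A) = refl
  ...   | no x≮A | yes y<A = ⊥-elim (x≮A (<-trans x<y y<A))
  ...   | no x≮A | no y≮A rewrite label-≥ (≮⇒≥ x≮A) | label-≥ (≮⇒≥ y≮A) =
            itinerary-monotone n (<⇒≤ (ψ-monotone x<y y<M (trans (label-≥ (≮⇒≥ x≮A)) (sym (label-≥ (≮⇒≥ y≮A)))))) (ψ-closed y<M)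

  -- The conjugates of the itinerary are the itineraries of the points 0, …, M - 1, which are
  -- already sorted by itinerary-monotone.
  module _ {x₀ : ℕ} (x₀<M : x₀ < M) (period : ExactPeriod (ψ L A) M x₀) where
    open Orbit ψ-closed ψ-injective x₀<M period

    private
      row : ℕ → Word
      row = itinerary (ψ L A) A M

    conjugates-itinerary : conjugates (row x₀) ≡ map row (applyUpTo orbit M)
    conjugates-itinerary = begin
        map (conj (row x₀)) (upTo (length (row x₀)))
      ≡⟨ cong (λ k → map (conj (row x₀)) (upTo k)) (length-itinerary (ψ L A) A M x₀) ⟩
        map (conj (row x₀)) (upTo M)
      ≡⟨ map-cong-local (All.map (λ j<M → sym (itinerary-rotate (ψ L A) A M x₀ _ (proj₁ period) (<⇒≤ j<M))) (all-upTo M)) ⟩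
        map (row ∘ orbit) (upTo M)
      ≡⟨ map-∘ (upTo M) ⟩
        map row (map orbit (upTo M))
      ≡⟨ cong (map row) (map-upTo orbit M) ⟩
        map row (applyUpTo orbit M)
      ∎ where open ≡-Reasoning

    sortWords-conjugates : sortWords (conjugates (row x₀)) ≡ applyUpTo row M
    sortWords-conjugates = sortWords-unique _ _
      (Linked.applyUpTo⁺₁ row M (λ {i} i+1<M → itinerary-monotone M (n≤1+n i) i+1<M))
      (subst (_↭ applyUpTo row M) (sym conjugates-itinerary)
        (subst (map row (applyUpTo orbit M) ↭_) (map-upTo row M) (↭.map⁺ row orbit-↭)))

    lastL-row : ∀ {x} → x < M → lastL (row x) ≡ at L x
    lastL-row {x} x<M with j , _ , refl ← orbit-surjective x<M = lastL-orbit (M ∸ 1) (m+[n∸m]≡n (≤-trans (s≤s z≤n) x<M))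
      where
      lastL-orbit : ∀ m → suc m ≡ M → lastL (row (orbit j)) ≡ at L (orbit j)
      lastL-orbit m refl = begin
          lastL (itinerary (ψ L A) A (suc m) (orbit j))
        ≡⟨ lastL-itinerary (ψ L A) A m (orbit j) ⟩
          label A (iterate (ψ L A) (orbit j) m)
        ≡⟨ sym (at-ψ (iterate-closed ψ-closed m (orbit-< j))) ⟩
          at L (ψ L A (iterate (ψ L A) (orbit j) m))
        ≡⟨ cong (at L) (trans (sym (iterate-suc (ψ L A) (orbit j) m)) (iterate-period j)) ⟩
          at L (orbit j)
        ∎ where open ≡-Reasoning

    bwt-itinerary : BWT (row x₀) ≡ L
    bwt-itinerary = begin
        map lastL (sortWords (conjugates (row x₀)))
      ≡⟨ cong (map lastL) sortWords-conjugates ⟩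
        map lastL (applyUpTo row M)
      ≡⟨ trans (map-applyUpTo row lastL M) (sym (map-upTo (lastL ∘ row) M)) ⟩
        map (lastL ∘ row) (upTo M)
      ≡⟨ map-cong-local (All.map lastL-row (all-upTo M)) ⟩
        map (at L) (upTo M)
      ≡⟨ trans (map-upTo (at L) M) (cong (applyUpTo (at L)) (sym length-L)) ⟩
        applyUpTo (at L) (length L)
      ≡⟨ applyUpTo-at L ⟩
        L
      ∎ where open ≡-Reasoning

-- Refining a cycle

module Refinement {g : ℕ → ℕ} {M ξ : ℕ} (g-closed : Closed g M) (ξ<M : ξ < M) (period : ExactPeriod g M ξ)
  (f e len : ℕ → ℕ)
  (step : ∀ {y} → y < M → iterate f (e y) (len y) ≡ e (g y))
  (avoid : ∀ {y} → y < M → ∀ t → 0 < t → t < len y → iterate f (e y) t ≢ e ξ)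
  (e-injective : ∀ {y} → y < M → e y ≡ e ξ → y ≡ ξ) where

  span : ℕ → ℕ → ℕ
  span zero y = 0
  span (suc j) y = len y + span j (g y)

  iterate-span : ∀ j {y} → y < M → iterate f (e y) (span j y) ≡ e (iterate g y j)
  iterate-span zero y<M = refl
  iterate-span (suc j) {y} y<M = begin
      iterate f (e y) (len y + span j (g y))
    ≡⟨ iterate-+ f (e y) (len y) (span j (g y)) ⟩
      iterate f (iterate f (e y) (len y)) (span j (g y))
    ≡⟨ cong (λ z → iterate f z (span j (g y))) (step y<M) ⟩
      iterate f (e (g y)) (span j (g y))
    ≡⟨ iterate-span j (g-closed y<M) ⟩
      e (iterate g (g y) j)
    ∎ where open ≡-Reasoning

  visits-e-ξ : ∀ j {y} → y < M → ∀ {t} → t < span j y → iterate f (e y) t ≡ e ξ →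
    ∃ λ i → i < j × t ≡ span i y × iterate g y i ≡ ξ
  visits-e-ξ zero _ ()
  visits-e-ξ (suc j) {y} y<M {t} t<span hit with t <? len y
  ... | yes t<len with t
  ...   | zero = 0 , s≤s z≤n , refl , e-injective y<M hit
  ...   | suc t' = ⊥-elim (avoid y<M (suc t') (s≤s z≤n) t<len hit)
  visits-e-ξ (suc j) {y} y<M {t} t<span hit | no t≮len = shift (visits-e-ξ j (g-closed y<M) t'<span hit')
    where
    t' : ℕ
    t' = t ∸ len y
    t≡len+t' : len y + t' ≡ t
    t≡len+t' = m+[n∸m]≡n (≮⇒≥ t≮len)
    t'<span : t' < span j (g y)
    t'<span = m≤n<m+o⇒n∸m<o (≮⇒≥ t≮len) t<span
    hit' : iterate f (e (g y)) t' ≡ e ξ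
    hit' = trans (sym (cong (λ z → iterate f z t') (step y<M)))
             (trans (sym (iterate-+ f (e y) (len y) t')) (trans (cong (iterate f (e y)) t≡len+t') hit))
    shift : (∃ λ i → i < j × t' ≡ span i (g y) × iterate g (g y) i ≡ ξ) →
            ∃ λ i → i < suc j × t ≡ span i y × iterate g y i ≡ ξ
    shift (i , i<j , t'≡span , ξ-hit) = suc i , s≤s i<j , trans (sym t≡len+t') (cong (len y +_) t'≡span) , ξ-hit

  exactPeriod-refined : ExactPeriod f (span M ξ) (e ξ)
  exactPeriod-refined = trans (iterate-span M ξ<M) (cong e (proj₁ period)) , no-return
    where
    no-return : ∀ t → 0 < t → t < span M ξ → iterate f (e ξ) t ≢ e ξ
    no-return t t>0 t<span hit with visits-e-ξ M ξ<M t<span hit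
    ... | zero , _ , refl , _ = <-irrefl refl t>0
    ... | suc i , i<M , _ , ξ-hit = proj₂ period (suc i) (s≤s z≤n) i<M ξ-hit

  module _ (σ : Letter → Word) (A A′ : ℕ)
    (segment : ∀ {y} → y < M → y ≢ ξ → itinerary f A′ (len y) (e y) ≡ σ (label A y)) where

    itinerary-span : ∀ j {y} → y < M → (∀ i → i < j → iterate g y i ≢ ξ) →
      itinerary f A′ (span j y) (e y) ≡ concatMap σ (itinerary g A j y)
    itinerary-span zero _ _ = refl
    itinerary-span (suc j) {y} y<M avoids-ξ = begin
        itinerary f A′ (len y + span j (g y)) (e y)
      ≡⟨ itinerary-+ f A′ (len y) (span j (g y)) (e y) ⟩
        itinerary f A′ (len y) (e y) ++ itinerary f A′ (span j (g y)) (iterate f (e y) (len y))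
      ≡⟨ cong₂ (λ u z → u ++ itinerary f A′ (span j (g y)) z) (segment y<M (avoids-ξ 0 (s≤s z≤n))) (step y<M) ⟩
        σ (label A y) ++ itinerary f A′ (span j (g y)) (e (g y))
      ≡⟨ cong (σ (label A y) ++_) (itinerary-span j (g-closed y<M) (λ i i<j → avoids-ξ (suc i) (s≤s i<j))) ⟩
        σ (label A y) ++ concatMap σ (itinerary g A j (g y))
      ∎ where open ≡-Reasoning

    itinerary-refined : ∀ m → suc m ≡ M →
      itinerary f A′ (span M ξ) (e ξ) ≡ itinerary f A′ (len ξ) (e ξ) ++ concatMap σ (itinerary g A m (g ξ))
    itinerary-refined m refl = begin
        itinerary f A′ (len ξ + span m (g ξ)) (e ξ)
      ≡⟨ itinerary-+ f A′ (len ξ) (span m (g ξ)) (e ξ) ⟩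
        itinerary f A′ (len ξ) (e ξ) ++ itinerary f A′ (span m (g ξ)) (iterate f (e ξ) (len ξ))
      ≡⟨ cong (λ z → itinerary f A′ (len ξ) (e ξ) ++ itinerary f A′ (span m (g ξ)) z) (step ξ<M) ⟩
        itinerary f A′ (len ξ) (e ξ) ++ itinerary f A′ (span m (g ξ)) (e (g ξ))
      ≡⟨ cong (itinerary f A′ (len ξ) (e ξ) ++_)
              (itinerary-span m (g-closed ξ<M) λ i i<m → proj₂ period (suc i) (s≤s z≤n) (s≤s i<m)) ⟩
        itinerary f A′ (len ξ) (e ξ) ++ concatMap σ (itinerary g A m (g ξ))
      ∎ where open ≡-Reasoning

-- Fibonacci words

φ : Letter → Word
φ a = a ∷ b ∷ []
φ b = a ∷ []

φ² : Letter → Word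
φ² a = a ∷ b ∷ a ∷ []
φ² b = a ∷ b ∷ []

concatMap-φ² : ∀ w → concatMap φ² w ≡ concatMap φ (concatMap φ w)
concatMap-φ² [] = refl
concatMap-φ² (a ∷ w) = cong (λ u → a ∷ b ∷ a ∷ u) (concatMap-φ² w)
concatMap-φ² (b ∷ w) = cong (λ u → a ∷ b ∷ u) (concatMap-φ² w)

concatMap-φ-fibWord : ∀ i → concatMap φ (fibWord i) ≡ fibWord (suc i)
concatMap-φ-fibWord zero = refl
concatMap-φ-fibWord (suc zero) = refl
concatMap-φ-fibWord (suc (suc i)) = trans (concatMap-++ φ (fibWord (suc i)) (fibWord i))
                                      (cong₂ _++_ (concatMap-φ-fibWord (suc i)) (concatMap-φ-fibWord i))

length-fibWord : ∀ i → length (fibWord i) ≡ F i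
length-fibWord zero = refl
length-fibWord (suc zero) = refl
length-fibWord (suc (suc i)) = trans (length-++ (fibWord (suc i))) (cong₂ _+_ (length-fibWord (suc i)) (length-fibWord i))

double : ℕ → ℕ
double zero = zero
double (suc n) = suc (suc (double n))

double≡2* : ∀ n → double n ≡ 2 * n
double≡2* zero = refl
double≡2* (suc n) = cong suc (trans (cong suc (double≡2* n)) (sym (+-suc n (n + 0))))

fibStem : ℕ → Word
fibStem zero = a ∷ b ∷ a ∷ []
fibStem (suc n) = concatMap φ² (fibStem n) ++ a ∷ b ∷ a ∷ []

fibWord-even : ∀ n → fibWord (4 + double n) ≡ fibStem n ++ a ∷ b ∷ []
fibWord-even zero = refl
fibWord-even (suc n) = begin
    fibWord (suc (suc (4 + double n)))
  ≡⟨ sym (trans (cong (concatMap φ) (concatMap-φ-fibWord (4 + double n))) (concatMap-φ-fibWord (5 + double n))) ⟩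
    concatMap φ (concatMap φ (fibWord (4 + double n)))
  ≡⟨ sym (concatMap-φ² (fibWord (4 + double n))) ⟩
    concatMap φ² (fibWord (4 + double n))
  ≡⟨ cong (concatMap φ²) (fibWord-even n) ⟩
    concatMap φ² (fibStem n ++ a ∷ b ∷ [])
  ≡⟨ concatMap-++ φ² (fibStem n) _ ⟩
    concatMap φ² (fibStem n) ++ a ∷ b ∷ a ∷ a ∷ b ∷ []
  ≡⟨ sym (++-assoc (concatMap φ² (fibStem n)) (a ∷ b ∷ a ∷ []) _) ⟩
    fibStem (suc n) ++ a ∷ b ∷ []
  ∎ where open ≡-Reasoning

hat-fibWord : ∀ n → hat (fibWord (2 * (2 + n))) ≡ fibStem n ++ a ∷ []
hat-fibWord n = begin
    take (length s ∸ 1) s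
  ≡⟨ cong (λ w → take (length w ∸ 1) w) s≡ ⟩
    take (length (u ++ b ∷ []) ∸ 1) (u ++ b ∷ [])
  ≡⟨ cong (λ k → take (k ∸ 1) (u ++ b ∷ [])) (trans (length-++ u) (+-comm (length u) 1)) ⟩
    take (length u) (u ++ b ∷ [])
  ≡⟨ take-length-++ u _ ⟩
    u
  ∎
  where
  open ≡-Reasoning
  s u : Word
  s = fibWord (2 * (2 + n))
  u = fibStem n ++ a ∷ []
  s≡ : s ≡ u ++ b ∷ []
  s≡ = trans (cong fibWord (sym (double≡2* (2 + n))))
         (trans (fibWord-even n) (sym (++-assoc (fibStem n) (a ∷ []) (b ∷ []))))

-- The claimed BWT

Fᵉ Fᵒ : ℕ → ℕ
Fᵉ n = F (double n)
Fᵒ n = F (suc (double n))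

F-positive : ∀ i → 0 < F i
F-positive zero = s≤s z≤n
F-positive (suc zero) = s≤s z≤n
F-positive (suc (suc i)) = ≤-trans (F-positive (suc i)) (m≤m+n _ _)

suc-≤-Fᵒ : ∀ n → suc n ≤ Fᵒ n
suc-≤-Fᵒ zero = s≤s z≤n
suc-≤-Fᵒ (suc n) = +-mono-≤ (F-positive (double (suc n))) (suc-≤-Fᵒ n)

-- Level n is the case k = n + 2 of the theorem: A n, B n and M n are the numbers of letters a,
-- of letters b and of all letters of the claimed BWT of ŝ.
A B M : ℕ → ℕ
A n = Fᵒ (suc n)
B n = Fᵉ (suc n) ∸ 1
M n = Fᵉ (suc (suc n)) ∸ 1

M≡A+B : ∀ n → M n ≡ A n + B n
M≡A+B n = +-∸-assoc (A n) (F-positive (double (suc n)))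

0<B : ∀ n → 0 < B n
0<B n = m<n⇒0<n∸m (+-mono-≤ (F-positive (suc (double n))) (F-positive (double n)))

suc-suc-≤-A : ∀ n → suc (suc n) ≤ A n
suc-suc-≤-A n = suc-≤-Fᵒ (suc n)

A≤M : ∀ n → A n ≤ M n
A≤M n = subst (A n ≤_) (sym (M≡A+B n)) (m≤m+n (A n) (B n))

suc-<-M : ∀ n → suc n < M n
suc-<-M n = <-≤-trans (suc-suc-≤-A n) (A≤M n)

0<M : ∀ n → 0 < M n
0<M n = ≤-<-trans z≤n (suc-<-M n)

gap trail : ℕ → ℕ
gap n = Fᵒ n ∸ suc n
trail n = Fᵒ (suc n) ∸ suc n

0<gap : ∀ n → 0 < gap (suc n)
0<gap n = m<n⇒0<n∸m (+-mono-≤ (+-mono-≤ (F-positive (suc (double n))) (F-positive (double n))) (suc-≤-Fᵒ n))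

0<trail : ∀ n → 0 < trail n
0<trail n = m<n⇒0<n∸m (suc-≤-Fᵒ (suc n))

Mid : ℕ → Word
Mid zero = []
Mid (suc n) = a ∷ (b ^ʷ Fᵒ n) ++ Mid n

fibBWTHead : ℕ → Word
fibBWTHead n = (b ^ʷ suc n) ++ a ∷ (b ^ʷ gap n) ++ Mid n

fibBWTRest : ℕ → Word
fibBWTRest n = (b ^ʷ gap n) ++ Mid n ++ (a ^ʷ trail n)

fibBWT : ℕ → Word
fibBWT n = (b ^ʷ suc n) ++ a ∷ (b ^ʷ gap n) ++ Mid n ++ (a ^ʷ trail n)

fibBWT≡head++trail : ∀ n → fibBWT n ≡ fibBWTHead n ++ (a ^ʷ trail n)
fibBWT≡head++trail n = trans (cong (λ u → (b ^ʷ suc n) ++ a ∷ u) (sym (++-assoc (b ^ʷ gap n) (Mid n) _)))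
                         (sym (++-assoc (b ^ʷ suc n) _ _))

replicate-+ : ∀ (x : Letter) m k → (x ^ʷ (m + k)) ≡ (x ^ʷ m) ++ (x ^ʷ k)
replicate-+ x zero k = refl
replicate-+ x (suc m) k = cong (x ∷_) (replicate-+ x m k)

count-replicate : ∀ x m → count x (x ^ʷ m) ≡ m
count-replicate x zero = refl
count-replicate a (suc m) = cong suc (count-replicate a m)
count-replicate b (suc m) = cong suc (count-replicate b m)

count-a-b^ : ∀ m → count a (b ^ʷ m) ≡ 0
count-a-b^ zero = refl
count-a-b^ (suc m) = count-a-b^ m

count-b-a^ : ∀ m → count b (a ^ʷ m) ≡ 0
count-b-a^ zero = refl
count-b-a^ (suc m) = count-b-a^ m

count-a-Mid : ∀ n → count a (Mid n) ≡ n
count-a-Mid zero = refl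
count-a-Mid (suc n) = cong suc (trans (count-++ a (b ^ʷ Fᵒ n) (Mid n)) (cong₂ _+_ (count-a-b^ (Fᵒ n)) (count-a-Mid n)))

suc-count-b-Mid : ∀ n → suc (count b (Mid n)) ≡ Fᵉ n
suc-count-b-Mid zero = refl
suc-count-b-Mid (suc n) = begin
    suc (count b ((b ^ʷ Fᵒ n) ++ Mid n))
  ≡⟨ cong suc (trans (count-++ b (b ^ʷ Fᵒ n) (Mid n)) (cong (_+ count b (Mid n)) (count-replicate b (Fᵒ n)))) ⟩
    suc (Fᵒ n + count b (Mid n))
  ≡⟨ trans (sym (+-suc (Fᵒ n) _)) (cong (Fᵒ n +_) (suc-count-b-Mid n)) ⟩
    Fᵒ n + Fᵉ n
  ∎ where open ≡-Reasoning

count-a-head : ∀ n → count a (fibBWTHead n) ≡ suc n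
count-a-head n = begin
    count a ((b ^ʷ suc n) ++ a ∷ (b ^ʷ gap n) ++ Mid n)
  ≡⟨ count-++ a (b ^ʷ suc n) _ ⟩
    count a (b ^ʷ suc n) + suc (count a ((b ^ʷ gap n) ++ Mid n))
  ≡⟨ cong₂ (λ p q → p + suc q) (count-a-b^ (suc n)) (count-++ a (b ^ʷ gap n) (Mid n)) ⟩
    suc (count a (b ^ʷ gap n) + count a (Mid n))
  ≡⟨ cong₂ (λ p q → suc (p + q)) (count-a-b^ (gap n)) (count-a-Mid n) ⟩
    suc n
  ∎ where open ≡-Reasoning

count-b-head : ∀ n → count b (fibBWTHead n) ≡ B n
count-b-head n = cong (_∸ 1) (begin
    suc (count b ((b ^ʷ suc n) ++ a ∷ (b ^ʷ gap n) ++ Mid n))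
  ≡⟨ cong suc (count-++ b (b ^ʷ suc n) _) ⟩
    suc (count b (b ^ʷ suc n) + count b ((b ^ʷ gap n) ++ Mid n))
  ≡⟨ cong₂ (λ p q → suc (p + q)) (count-replicate b (suc n)) (count-++ b (b ^ʷ gap n) (Mid n)) ⟩
    suc (suc n + (count b (b ^ʷ gap n) + count b (Mid n)))
  ≡⟨ cong (λ p → suc (suc n + (p + count b (Mid n)))) (count-replicate b (gap n)) ⟩
    suc (suc n + (gap n + count b (Mid n)))
  ≡⟨ trans (cong suc (sym (+-assoc (suc n) (gap n) _))) (sym (+-suc (suc n + gap n) _)) ⟩
    (suc n + gap n) + suc (count b (Mid n))
  ≡⟨ cong₂ _+_ (m+[n∸m]≡n (suc-≤-Fᵒ n)) (suc-count-b-Mid n) ⟩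
    Fᵒ n + Fᵉ n
  ∎) where open ≡-Reasoning

suc+trail≡A : ∀ n → suc n + trail n ≡ A n
suc+trail≡A n = m+[n∸m]≡n (≤-trans (n≤1+n (suc n)) (suc-≤-Fᵒ (suc n)))

count-a-fibBWT : ∀ n → count a (fibBWT n) ≡ A n
count-a-fibBWT n = begin
    count a (fibBWT n)
  ≡⟨ cong (count a) (fibBWT≡head++trail n) ⟩
    count a (fibBWTHead n ++ (a ^ʷ trail n))
  ≡⟨ count-++ a (fibBWTHead n) _ ⟩
    count a (fibBWTHead n) + count a (a ^ʷ trail n)
  ≡⟨ cong₂ _+_ (count-a-head n) (count-replicate a (trail n)) ⟩
    suc n + trail n
  ≡⟨ suc+trail≡A n ⟩
    A n
  ∎ where open ≡-Reasoning

count-b-fibBWT : ∀ n → count b (fibBWT n) ≡ B n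
count-b-fibBWT n = begin
    count b (fibBWT n)
  ≡⟨ cong (count b) (fibBWT≡head++trail n) ⟩
    count b (fibBWTHead n ++ (a ^ʷ trail n))
  ≡⟨ count-++ b (fibBWTHead n) _ ⟩
    count b (fibBWTHead n) + count b (a ^ʷ trail n)
  ≡⟨ cong₂ _+_ (count-b-head n) (count-b-a^ (trail n)) ⟩
    B n + 0
  ≡⟨ +-identityʳ (B n) ⟩
    B n
  ∎ where open ≡-Reasoning

length-head : ∀ n → length (fibBWTHead n) ≡ suc n + B n
length-head n = trans (length≡count-a+count-b (fibBWTHead n)) (cong₂ _+_ (count-a-head n) (count-b-head n))

length-fibBWT : ∀ n → length (fibBWT n) ≡ M n
length-fibBWT n = trans (length≡count-a+count-b (fibBWT n))
                    (trans (cong₂ _+_ (count-a-fibBWT n) (count-b-fibBWT n)) (sym (M≡A+B n)))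

module Level (n : ℕ) = StandardPermutation (fibBWT n) (count-a-fibBWT n) (length-fibBWT n)

select-b-b^-< : ∀ m v {i} → i < m → select b ((b ^ʷ m) ++ v) i ≡ i
select-b-b^-< (suc m) v {zero} _ = refl
select-b-b^-< (suc m) v {suc i} (s≤s i<m) = cong suc (select-b-b^-< m v i<m)

select-b-b^-+ : ∀ m v i → select b ((b ^ʷ m) ++ v) (m + i) ≡ m + select b v i
select-b-b^-+ zero v i = refl
select-b-b^-+ (suc m) v i = cong suc (select-b-b^-+ m v i)

select-a-b^ : ∀ m v i → select a ((b ^ʷ m) ++ v) i ≡ m + select a v i
select-a-b^ zero v i = refl
select-a-b^ (suc m) v i = cong suc (select-a-b^ m v i)

select-a-a^-< : ∀ m {i} → i < m → select a (a ^ʷ m) i ≡ i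
select-a-a^-< (suc m) {zero} _ = refl
select-a-a^-< (suc m) {suc i} (s≤s i<m) = cong suc (select-a-a^-< m i<m)

Ψ : ℕ → ℕ → ℕ
Ψ n = ψ (fibBWT n) (A n)

Ψ-trail : ∀ n {x} → suc n ≤ x → x < A n → Ψ n x ≡ x + B n
Ψ-trail n {x} n<x x<A = begin
    ψ (fibBWT n) (A n) x
  ≡⟨ ψ-< (fibBWT n) x<A ⟩
    select a (fibBWT n) x
  ≡⟨ cong₂ (select a) (fibBWT≡head++trail n) (sym x≡) ⟩
    select a (fibBWTHead n ++ (a ^ʷ trail n)) (count a (fibBWTHead n) + i)
  ≡⟨ select-++ʳ a (fibBWTHead n) _ i ⟩
    length (fibBWTHead n) + select a (a ^ʷ trail n) i
  ≡⟨ cong₂ _+_ (length-head n) (select-a-a^-< (trail n) (m≤n<m+o⇒n∸m<o n<x x<A')) ⟩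
    suc n + B n + i
  ≡⟨ +-right-comm (suc n) (B n) i ⟩
    (suc n + i) + B n
  ≡⟨ cong (_+ B n) (m+[n∸m]≡n n<x) ⟩
    x + B n
  ∎
  where
  open ≡-Reasoning
  i : ℕ
  i = x ∸ suc n
  x≡ : count a (fibBWTHead n) + i ≡ x
  x≡ = trans (cong (_+ i) (count-a-head n)) (m+[n∸m]≡n n<x)
  x<A' : x < suc n + trail n
  x<A' = subst (x <_) (sym (suc+trail≡A n)) x<A

select-b-fibBWT-< : ∀ n {u} → u < suc n → select b (fibBWT n) u ≡ u
select-b-fibBWT-< n = select-b-b^-< (suc n) _

select-b-fibBWT-+ : ∀ n v → select b (fibBWT n) (suc n + v) ≡ suc (suc n) + select b (fibBWTRest n) v
select-b-fibBWT-+ n v = trans (select-b-b^-+ (suc n) (a ∷ fibBWTRest n) v) (+-suc (suc n) _)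

select-a-fibBWT-0 : ∀ n → select a (fibBWT n) 0 ≡ suc n
select-a-fibBWT-0 n = trans (select-a-b^ (suc n) (a ∷ fibBWTRest n) 0) (+-identityʳ (suc n))

select-a-fibBWT-suc : ∀ n {j} → j < n → select a (fibBWT n) (suc j) ≡ suc (Fᵒ n) + select a (Mid n) j
select-a-fibBWT-suc n {j} j<n = begin
    select a (fibBWT n) (suc j)
  ≡⟨ select-a-b^ (suc n) (a ∷ fibBWTRest n) (suc j) ⟩
    suc n + suc (select a ((b ^ʷ gap n) ++ Mid n ++ (a ^ʷ trail n)) j)
  ≡⟨ cong (λ z → suc n + suc z) (select-a-b^ (gap n) _ j) ⟩
    suc n + suc (gap n + select a (Mid n ++ (a ^ʷ trail n)) j)
  ≡⟨ cong (λ z → suc n + suc (gap n + z)) (select-++ˡ a (Mid n) _ j (subst (j <_) (sym (count-a-Mid n)) j<n)) ⟩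
    suc n + suc (gap n + select a (Mid n) j)
  ≡⟨ trans (+-suc (suc n) _) (cong suc (sym (+-assoc (suc n) (gap n) _))) ⟩
    suc ((suc n + gap n) + select a (Mid n) j)
  ≡⟨ cong (λ z → suc (z + select a (Mid n) j)) (m+[n∸m]≡n (suc-≤-Fᵒ n)) ⟩
    suc (Fᵒ n) + select a (Mid n) j
  ∎ where open ≡-Reasoning

select-a-fibBWT-1 : ∀ n → select a (fibBWT (suc n)) 1 ≡ suc (A n)
select-a-fibBWT-1 n = trans (select-a-fibBWT-suc (suc n) (s≤s z≤n)) (+-identityʳ _)

select-a-fibBWT-suc-suc : ∀ n {j} → j < n →
  select a (fibBWT (suc n)) (suc (suc j)) ≡ suc (A n) + select a (fibBWT n) (suc j)
select-a-fibBWT-suc-suc n {j} j<n = begin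
    select a (fibBWT (suc n)) (suc (suc j))
  ≡⟨ select-a-fibBWT-suc (suc n) (s≤s j<n) ⟩
    suc (A n) + suc (select a ((b ^ʷ Fᵒ n) ++ Mid n) j)
  ≡⟨ cong (λ z → suc (A n) + suc z) (select-a-b^ (Fᵒ n) (Mid n) j) ⟩
    suc (A n) + suc (Fᵒ n + select a (Mid n) j)
  ≡⟨ cong (suc (A n) +_) (sym (select-a-fibBWT-suc n j<n)) ⟩
    suc (A n) + select a (fibBWT n) (suc j)
  ∎ where open ≡-Reasoning

select-b-fibBWT-gap : ∀ n {u} → suc (suc n) ≤ u → u < A n → select b (fibBWT (suc n)) u ≡ suc u
select-b-fibBWT-gap n {u} n+1<u u<A = begin
    select b (fibBWT (suc n)) u
  ≡⟨ cong (select b (fibBWT (suc n))) (sym u≡) ⟩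
    select b (fibBWT (suc n)) (suc (suc n) + v)
  ≡⟨ select-b-fibBWT-+ (suc n) v ⟩
    suc (suc (suc n)) + select b (fibBWTRest (suc n)) v
  ≡⟨ cong (suc (suc (suc n)) +_) (select-b-b^-< (gap (suc n)) _ (∸-monoˡ-< u<A n+1<u)) ⟩
    suc (suc (suc n) + v)
  ≡⟨ cong suc u≡ ⟩
    suc u
  ∎
  where
  open ≡-Reasoning
  v : ℕ
  v = u ∸ suc (suc n)
  u≡ : suc (suc n) + v ≡ u
  u≡ = m+[n∸m]≡n n+1<u

select-b-fibBWT-A+ : ∀ n {v} → v < count b ((b ^ʷ Fᵒ n) ++ Mid n) →
  select b (fibBWT (suc n)) (A n + v) ≡ suc (suc (A n)) + select b ((b ^ʷ Fᵒ n) ++ Mid n) v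
select-b-fibBWT-A+ n {v} v<count = begin
    select b (fibBWT (suc n)) (A n + v)
  ≡⟨ cong (select b (fibBWT (suc n))) (trans (cong (_+ v) (sym n+1+gap)) (+-assoc (suc (suc n)) (gap (suc n)) v)) ⟩
    select b (fibBWT (suc n)) (suc (suc n) + (gap (suc n) + v))
  ≡⟨ select-b-fibBWT-+ (suc n) (gap (suc n) + v) ⟩
    suc (suc (suc n)) + select b ((b ^ʷ gap (suc n)) ++ a ∷ Y ++ (a ^ʷ trail (suc n))) (gap (suc n) + v)
  ≡⟨ cong (suc (suc (suc n)) +_) (select-b-b^-+ (gap (suc n)) _ v) ⟩
    suc (suc (suc n)) + (gap (suc n) + suc (select b (Y ++ (a ^ʷ trail (suc n))) v))
  ≡⟨ cong (λ z → suc (suc (suc n)) + (gap (suc n) + suc z)) (select-++ˡ b Y _ v v<count) ⟩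
    suc (suc (suc n)) + (gap (suc n) + suc (select b Y v))
  ≡⟨ arith (suc (suc n)) (gap (suc n)) (select b Y v) ⟩
    suc (suc (suc (suc n) + gap (suc n))) + select b Y v
  ≡⟨ cong (λ z → suc (suc z) + select b Y v) n+1+gap ⟩
    suc (suc (A n)) + select b Y v
  ∎
  where
  open ≡-Reasoning
  Y : Word
  Y = (b ^ʷ Fᵒ n) ++ Mid n
  n+1+gap : suc (suc n) + gap (suc n) ≡ A n
  n+1+gap = m+[n∸m]≡n (suc-≤-Fᵒ (suc n))
  arith : ∀ p g s → suc p + (g + suc s) ≡ suc (suc (p + g)) + s
  arith = solve-∀

-- From level n to level n + 1

-- Ψ (suc n) refines Ψ n with ξ = n + 1: y is embedded as δ + π y, and the step y ↦ Ψ n y becomes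
-- the Path through points y, whose labels spell φ² (label (A n) y), or a b a a for y = ξ.
module Step (n : ℕ) where

  A′ δ : ℕ
  A′ = A (suc n)
  δ = suc (A n)

  Ψ′ : ℕ → ℕ
  Ψ′ = Ψ (suc n)

  π : ℕ → ℕ
  π y = if y <ᵇ suc n then suc y else (if y ≡ᵇ suc n then 0 else y)

  embed : ℕ → ℕ
  embed y = δ + π y

  points : ℕ → List ℕ
  points y = if y ≡ᵇ suc n then A′ ∷ 0 ∷ suc (suc n) ∷ []
             else (if y <ᵇ A n then A′ + π y ∷ suc y ∷ [] else A′ + y ∷ [])

  len : ℕ → ℕ
  len y = suc (length (points y))

  π-≤ : ∀ {y} → y < suc n → π y ≡ suc y
  π-≤ = if-<ᵇ-yes

  π-ξ : π (suc n) ≡ 0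
  π-ξ = trans (if-<ᵇ-no {x = suc n} {suc n} ≤-refl) (if-≡ᵇ-yes {x = suc n} {suc n} refl)

  π-> : ∀ {y} → suc n < y → π y ≡ y
  π-> n+1<y = trans (if-<ᵇ-no (<⇒≤ n+1<y)) (if-≡ᵇ-no (>⇒≢ n+1<y))

  π≡0⇒ξ : ∀ {y} → π y ≡ 0 → y ≡ suc n
  π≡0⇒ξ {y} πy≡0 with <-cmp y (suc n)
  ... | tri< y<ξ _ _ with () ← trans (sym (π-≤ y<ξ)) πy≡0
  ... | tri≈ _ y≡ξ _ = y≡ξ
  ... | tri> _ _ ξ<y = ⊥-elim (n≮0 (subst (suc n <_) (trans (sym (π-> ξ<y)) πy≡0) ξ<y))

  δ+M≡A′ : δ + M n ≡ A′
  δ+M≡A′ = trans (sym (+-suc (A n) (M n)))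
             (trans (cong (A n +_) (m+[n∸m]≡n (F-positive (double (suc (suc n)))))) (+-comm (A n) _))

  π-< : ∀ {y} → y < M n → π y < M n
  π-< {y} y<M with <-cmp y (suc n)
  ... | tri< y<ξ _ _ = subst (_< M n) (sym (π-≤ y<ξ)) (≤-<-trans y<ξ (suc-<-M n))
  ... | tri≈ _ refl _ = subst (_< M n) (sym π-ξ) (0<M n)
  ... | tri> _ _ ξ<y = subst (_< M n) (sym (π-> ξ<y)) y<M

  embed-< : ∀ {y} → y < M n → embed y < A′
  embed-< {y} y<M = subst (embed y <_) δ+M≡A′ (+-monoʳ-< δ (π-< y<M))

  n+2<A′ : suc (suc n) < A′
  n+2<A′ = suc-suc-≤-A (suc n)

  δ<A′ : δ < A′
  δ<A′ = subst (δ <_) δ+M≡A′ (m<m+n δ (0<M n))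

  enter : ∀ {u} → u < M n → Ψ′ (δ + u) ≡ A′ + u
  enter {u} u<M = begin
      Ψ′ (δ + u)
    ≡⟨ Ψ-trail (suc n) (≤-trans (suc-suc-≤-A n) (≤-trans (n≤1+n (A n)) (m≤m+n δ u))) δ+u<A′ ⟩
      δ + u + M n
    ≡⟨ +-right-comm δ u (M n) ⟩
      δ + M n + u
    ≡⟨ cong (_+ u) δ+M≡A′ ⟩
      A′ + u
    ∎
    where
    open ≡-Reasoning
    δ+u<A′ : δ + u < A′
    δ+u<A′ = subst (δ + u <_) δ+M≡A′ (+-monoʳ-< δ u<M)

  leave-trail : ∀ {y} → suc n ≤ y → y < A n → Ψ′ (suc y) ≡ embed (Ψ n y)
  leave-trail {y} n<y y<A = begin
      Ψ′ (suc y)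
    ≡⟨ Ψ-trail (suc n) (s≤s n<y) (<-trans (s≤s y<A) δ<A′) ⟩
      suc y + M n
    ≡⟨ cong (suc y +_) (M≡A+B n) ⟩
      suc y + (A n + B n)
    ≡⟨ arith y (A n) (B n) ⟩
      δ + (y + B n)
    ≡⟨ cong (δ +_) (sym (π-> (≤-<-trans n<y (m<m+n y (0<B n))))) ⟩
      δ + π (y + B n)
    ≡⟨ cong embed (sym (Ψ-trail n n<y y<A)) ⟩
      embed (Ψ n y)
    ∎
    where
    open ≡-Reasoning
    arith : ∀ y p q → suc y + (p + q) ≡ suc p + (y + q)
    arith = solve-∀

  data Class (y : ℕ) : Set where
    ξ-class : y ≡ suc n → Class y
    a-class : y < A n → y ≢ suc n → Class y
    b-class : A n ≤ y → Class y

  classify : ∀ y → Class y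
  classify y with y ≟ suc n | y <? A n
  ... | yes y≡ξ | _ = ξ-class y≡ξ
  ... | no y≢ξ | yes y<A = a-class y<A y≢ξ
  ... | no _ | no y≮A = b-class (≮⇒≥ y≮A)

  data AClass : ℕ → Set where
    a-zero : AClass 0
    a-low : ∀ {j} → j < n → AClass (suc j)
    a-high : ∀ {y} → suc n < y → y < A n → AClass y

  a-classify : ∀ {y} → y < A n → y ≢ suc n → AClass y
  a-classify {zero} _ _ = a-zero
  a-classify {suc j} y<A y≢ξ with <-cmp j n
  ... | tri< j<n _ _ = a-low j<n
  ... | tri≈ _ refl _ = ⊥-elim (y≢ξ refl)
  ... | tri> _ _ n<j = a-high (s≤s n<j) y<A

  turn-≤ : ∀ {y} → y < suc n → Ψ′ (A′ + π y) ≡ suc y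
  turn-≤ {y} y≤n = trans (cong (λ u → Ψ′ (A′ + u)) (π-≤ y≤n))
                     (trans (ψ-+ (fibBWT (suc n)) A′ (suc y)) (select-b-fibBWT-< (suc n) (s≤s y≤n)))

  turn : ∀ {y} → AClass y → Ψ′ (A′ + π y) ≡ suc y
  turn a-zero = turn-≤ (s≤s z≤n)
  turn (a-low j<n) = turn-≤ (s≤s j<n)
  turn (a-high n+1<y y<A) = trans (cong (λ u → Ψ′ (A′ + u)) (π-> n+1<y))
                              (trans (ψ-+ (fibBWT (suc n)) A′ _) (select-b-fibBWT-gap n n+1<y y<A))

  leave : ∀ {y} → AClass y → Ψ′ (suc y) ≡ embed (Ψ n y)
  leave a-zero = begin
      Ψ′ 1
    ≡⟨ ψ-< (fibBWT (suc n)) (≤-trans (s≤s (s≤s z≤n)) (<⇒≤ n+2<A′)) ⟩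
      select a (fibBWT (suc n)) 1
    ≡⟨ trans (select-a-fibBWT-1 n) (sym (+-identityʳ δ)) ⟩
      δ + 0
    ≡⟨ cong (δ +_) (sym π-ξ) ⟩
      embed (suc n)
    ≡⟨ cong embed (sym (trans (ψ-< (fibBWT n) (<-≤-trans (s≤s z≤n) (suc-suc-≤-A n))) (select-a-fibBWT-0 n))) ⟩
      embed (Ψ n 0)
    ∎ where open ≡-Reasoning
  leave (a-low {j} j<n) = begin
      Ψ′ (suc (suc j))
    ≡⟨ ψ-< (fibBWT (suc n)) (≤-trans (s≤s (s≤s j<n)) (<⇒≤ n+2<A′)) ⟩
      select a (fibBWT (suc n)) (suc (suc j))
    ≡⟨ select-a-fibBWT-suc-suc n j<n ⟩
      δ + select a (fibBWT n) (suc j)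
    ≡⟨ cong (δ +_) (sym (ψ-< (fibBWT n) j+1<A)) ⟩
      δ + Ψ n (suc j)
    ≡⟨ cong (δ +_) (sym (π-> n+1<Ψ)) ⟩
      embed (Ψ n (suc j))
    ∎
    where
    open ≡-Reasoning
    j+1<A : suc j < A n
    j+1<A = <-trans (s≤s j<n) (suc-suc-≤-A n)
    n+1<Ψ : suc n < Ψ n (suc j)
    n+1<Ψ = subst (suc n <_) (sym (trans (ψ-< (fibBWT n) j+1<A) (select-a-fibBWT-suc n j<n)))
              (s≤s (≤-trans (suc-≤-Fᵒ n) (m≤m+n (Fᵒ n) _)))
  leave (a-high n+1<y y<A) = leave-trail (<⇒≤ n+1<y) y<A

  gapMid : Word
  gapMid = (b ^ʷ gap n) ++ Mid n

  stem-split : (b ^ʷ Fᵒ n) ++ Mid n ≡ (b ^ʷ suc n) ++ gapMid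
  stem-split = trans (cong (λ k → (b ^ʷ k) ++ Mid n) (sym (m+[n∸m]≡n (suc-≤-Fᵒ n))))
                 (trans (cong (_++ Mid n) (replicate-+ b (suc n) (gap n))) (++-assoc (b ^ʷ suc n) _ _))

  count-b-b^-gapMid : count b ((b ^ʷ suc n) ++ gapMid) ≡ suc n + count b gapMid
  count-b-b^-gapMid = trans (count-++ b (b ^ʷ suc n) gapMid) (cong (_+ count b gapMid) (count-replicate b (suc n)))

  B≡ : B n ≡ suc n + count b gapMid
  B≡ = trans (sym (count-b-head n)) (trans (count-++ b (b ^ʷ suc n) (a ∷ gapMid)) (cong (_+ count b gapMid) (count-replicate b (suc n))))

  count-b-stem : count b ((b ^ʷ Fᵒ n) ++ Mid n) ≡ B n
  count-b-stem = trans (cong (count b) stem-split) (trans count-b-b^-gapMid (sym B≡))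

  b-leave-≤ : ∀ {v} → v < suc n → v < B n → Ψ′ (A′ + (A n + v)) ≡ embed (Ψ n (A n + v))
  b-leave-≤ {v} v≤n v<B = begin
      Ψ′ (A′ + (A n + v))
    ≡⟨ ψ-+ (fibBWT (suc n)) A′ (A n + v) ⟩
      select b (fibBWT (suc n)) (A n + v)
    ≡⟨ select-b-fibBWT-A+ n (subst (v <_) (sym count-b-stem) v<B) ⟩
      suc (suc (A n)) + select b ((b ^ʷ Fᵒ n) ++ Mid n) v
    ≡⟨ cong (suc (suc (A n)) +_) (select-b-b^-< (Fᵒ n) (Mid n) (<-≤-trans v≤n (suc-≤-Fᵒ n))) ⟩
      suc (suc (A n)) + v
    ≡⟨ trans (sym (+-suc δ v)) (cong (δ +_) (sym (π-≤ v≤n))) ⟩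
      embed v
    ≡⟨ cong embed (sym (trans (ψ-+ (fibBWT n) (A n) v) (select-b-fibBWT-< n v≤n))) ⟩
      embed (Ψ n (A n + v))
    ∎ where open ≡-Reasoning

  b-leave-> : ∀ {v} → suc n ≤ v → v < B n → Ψ′ (A′ + (A n + v)) ≡ embed (Ψ n (A n + v))
  b-leave-> {v} n<v v<B = begin
      Ψ′ (A′ + (A n + v))
    ≡⟨ ψ-+ (fibBWT (suc n)) A′ (A n + v) ⟩
      select b (fibBWT (suc n)) (A n + v)
    ≡⟨ select-b-fibBWT-A+ n (subst (v <_) (sym count-b-stem) v<B) ⟩
      suc (suc (A n)) + select b ((b ^ʷ Fᵒ n) ++ Mid n) v
    ≡⟨ cong₂ (λ w i → suc (suc (A n)) + select b w i) stem-split (sym v≡) ⟩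
      suc (suc (A n)) + select b ((b ^ʷ suc n) ++ gapMid) (suc n + v′)
    ≡⟨ cong (suc (suc (A n)) +_) (select-b-b^-+ (suc n) gapMid v′) ⟩
      suc (suc (A n)) + (suc n + s)
    ≡⟨ arith (A n) n s ⟩
      δ + (suc (suc n) + s)
    ≡⟨ cong (δ +_) (sym (π-> (m≤m+n (suc (suc n)) s))) ⟩
      embed (suc (suc n) + s)
    ≡⟨ cong embed (sym Ψ≡) ⟩
      embed (Ψ n (A n + v))
    ∎
    where
    open ≡-Reasoning
    v′ s : ℕ
    v′ = v ∸ suc n
    s = select b gapMid v′
    v≡ : suc n + v′ ≡ v
    v≡ = m+[n∸m]≡n n<v
    Ψ≡ : Ψ n (A n + v) ≡ suc (suc n) + s
    Ψ≡ = begin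
        Ψ n (A n + v)
      ≡⟨ trans (ψ-+ (fibBWT n) (A n) v) (cong (select b (fibBWT n)) (sym v≡)) ⟩
        select b (fibBWT n) (suc n + v′)
      ≡⟨ select-b-fibBWT-+ n v′ ⟩
        suc (suc n) + select b (fibBWTRest n) v′
      ≡⟨ cong (λ w → suc (suc n) + select b w v′) (sym (++-assoc (b ^ʷ gap n) (Mid n) _)) ⟩
        suc (suc n) + select b (gapMid ++ (a ^ʷ trail n)) v′
      ≡⟨ cong (suc (suc n) +_) (select-++ˡ b gapMid _ v′ (m≤n<m+o⇒n∸m<o n<v (subst (v <_) B≡ v<B))) ⟩
        suc (suc n) + s
      ∎
    arith : ∀ p n s → suc (suc p) + (suc n + s) ≡ suc p + (suc (suc n) + s)
    arith = solve-∀

  b-leave : ∀ {v} → v < B n → Ψ′ (A′ + (A n + v)) ≡ embed (Ψ n (A n + v))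
  b-leave {v} v<B with v <? suc n
  ... | yes v≤n = b-leave-≤ v≤n v<B
  ... | no v≰n = b-leave-> (≮⇒≥ v≰n) v<B

  ξ-path : Path Ψ′ (embed (suc n)) (A′ ∷ 0 ∷ suc (suc n) ∷ []) (embed (Ψ n (suc n)))
  ξ-path = to-A′ ∷ to-0 ∷ to-n+2 ∷ [ leave-trail ≤-refl (suc-suc-≤-A n) ]
    where
    to-A′ : Ψ′ (embed (suc n)) ≡ A′
    to-A′ = trans (cong (λ u → Ψ′ (δ + u)) π-ξ) (trans (enter (0<M n)) (+-identityʳ A′))
    to-0 : Ψ′ A′ ≡ 0
    to-0 = trans (cong Ψ′ (sym (+-identityʳ A′)))
             (trans (ψ-+ (fibBWT (suc n)) A′ 0) (select-b-fibBWT-< (suc n) (s≤s z≤n)))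
    to-n+2 : Ψ′ 0 ≡ suc (suc n)
    to-n+2 = trans (ψ-< (fibBWT (suc n)) (≤-<-trans z≤n n+2<A′)) (select-a-fibBWT-0 (suc n))

  a-path : ∀ {y} → y < A n → y ≢ suc n → Path Ψ′ (embed y) (A′ + π y ∷ suc y ∷ []) (embed (Ψ n y))
  a-path y<A y≢ξ = enter (π-< (<-≤-trans y<A (A≤M n))) ∷ turn class ∷ [ leave class ]
    where class = a-classify y<A y≢ξ

  b-path : ∀ {y} → A n ≤ y → y < M n → Path Ψ′ (embed y) (A′ + y ∷ []) (embed (Ψ n y))
  b-path {y} A≤y y<M with v , refl ← m≤n⇒∃[o]m+o≡n A≤y =
    trans (cong (λ u → Ψ′ (δ + u)) (π-> (<-≤-trans (suc-suc-≤-A n) A≤y))) (enter y<M) ∷ [ b-leave v<B ]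
    where
    v<B : v < B n
    v<B = +-cancelˡ-< (A n) v (B n) (subst (A n + v <_) (M≡A+B n) y<M)

  ξ≢ : ∀ {y} → A n ≤ y → y ≢ suc n
  ξ≢ A≤y refl = <⇒≱ (suc-suc-≤-A n) A≤y

  points-ξ : points (suc n) ≡ A′ ∷ 0 ∷ suc (suc n) ∷ []
  points-ξ = if-≡ᵇ-yes {x = suc n} {suc n} refl

  points-a : ∀ {y} → y < A n → y ≢ suc n → points y ≡ A′ + π y ∷ suc y ∷ []
  points-a y<A y≢ξ = trans (if-≡ᵇ-no y≢ξ) (if-<ᵇ-yes y<A)

  points-b : ∀ {y} → A n ≤ y → points y ≡ A′ + y ∷ []
  points-b A≤y = trans (if-≡ᵇ-no (ξ≢ A≤y)) (if-<ᵇ-no A≤y)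

  path : ∀ {y} → y < M n → Path Ψ′ (embed y) (points y) (embed (Ψ n y))
  path {y} y<M with classify y
  ... | ξ-class refl = subst (λ ps → Path Ψ′ (embed y) ps (embed (Ψ n y))) (sym points-ξ) ξ-path
  ... | a-class y<A y≢ξ = subst (λ ps → Path Ψ′ (embed y) ps (embed (Ψ n y))) (sym (points-a y<A y≢ξ)) (a-path y<A y≢ξ)
  ... | b-class A≤y = subst (λ ps → Path Ψ′ (embed y) ps (embed (Ψ n y))) (sym (points-b A≤y)) (b-path A≤y y<M)

  embed-ξ : embed (suc n) ≡ δ
  embed-ξ = trans (cong (δ +_) π-ξ) (+-identityʳ δ)

  embed-injective : ∀ {y} → y < M n → embed y ≡ embed (suc n) → y ≡ suc n
  embed-injective _ eq = π≡0⇒ξ (trans (+-cancelˡ-≡ δ _ _ eq) π-ξ)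

  above : ∀ {z} → A′ ≤ z → z ≢ embed (suc n)
  above A′≤z z≡ = <⇒≱ δ<A′ (subst (A′ ≤_) (trans z≡ embed-ξ) A′≤z)

  below : ∀ {z} → z < δ → z ≢ embed (suc n)
  below z<δ z≡ = <⇒≢ z<δ (trans z≡ embed-ξ)

  points-avoid : ∀ {y} → y < M n → All (_≢ embed (suc n)) (points y)
  points-avoid {y} y<M with classify y
  ... | ξ-class refl = subst (All _) (sym points-ξ) (above ≤-refl ∷ below (s≤s z≤n) ∷ below (s≤s (suc-suc-≤-A n)) ∷ [])
  ... | a-class y<A y≢ξ = subst (All _) (sym (points-a y<A y≢ξ)) (above (m≤m+n A′ _) ∷ below (s≤s y<A) ∷ [])
  ... | b-class A≤y = subst (All _) (sym (points-b A≤y)) (above (m≤m+n A′ y) ∷ [])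

  avoid : ∀ {y} → y < M n → ∀ t → 0 < t → t < len y → iterate Ψ′ (embed y) t ≢ embed (suc n)
  avoid y<M = path-inner (path y<M) (points-avoid y<M)

  segment : ∀ {y} → y < M n → y ≢ suc n → itinerary Ψ′ A′ (len y) (embed y) ≡ φ² (label (A n) y)
  segment {y} y<M y≢ξ with classify y
  ... | ξ-class y≡ξ = ⊥-elim (y≢ξ y≡ξ)
  ... | a-class y<A _ = begin
      itinerary Ψ′ A′ (len y) (embed y)
    ≡⟨ path-itinerary A′ (path y<M) ⟩
      label A′ (embed y) ∷ map (label A′) (points y)
    ≡⟨ cong (λ ps → label A′ (embed y) ∷ map (label A′) ps) (points-a y<A y≢ξ) ⟩
      label A′ (embed y) ∷ label A′ (A′ + π y) ∷ label A′ (suc y) ∷ []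
    ≡⟨ cong₂ _∷_ (label-< (embed-< y<M)) (cong₂ _∷_ (label-≥ (m≤m+n A′ _)) (cong (_∷ []) (label-< (<-trans (s≤s y<A) δ<A′)))) ⟩
      φ² a
    ≡⟨ cong φ² (sym (label-< y<A)) ⟩
      φ² (label (A n) y)
    ∎ where open ≡-Reasoning
  ... | b-class A≤y = begin
      itinerary Ψ′ A′ (len y) (embed y)
    ≡⟨ path-itinerary A′ (path y<M) ⟩
      label A′ (embed y) ∷ map (label A′) (points y)
    ≡⟨ cong (λ ps → label A′ (embed y) ∷ map (label A′) ps) (points-b A≤y) ⟩
      label A′ (embed y) ∷ label A′ (A′ + y) ∷ []
    ≡⟨ cong₂ _∷_ (label-< (embed-< y<M)) (cong (_∷ []) (label-≥ (m≤m+n A′ y))) ⟩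
      φ² b
    ≡⟨ cong φ² (sym (label-≥ A≤y)) ⟩
      φ² (label (A n) y)
    ∎ where open ≡-Reasoning

  ξ-segment : itinerary Ψ′ A′ (len (suc n)) (embed (suc n)) ≡ a ∷ b ∷ a ∷ a ∷ []
  ξ-segment = begin
      itinerary Ψ′ A′ (len (suc n)) (embed (suc n))
    ≡⟨ cong (λ ps → itinerary Ψ′ A′ (suc (length ps)) (embed (suc n))) points-ξ ⟩
      itinerary Ψ′ A′ 4 (embed (suc n))
    ≡⟨ path-itinerary A′ ξ-path ⟩
      label A′ (embed (suc n)) ∷ label A′ A′ ∷ label A′ 0 ∷ label A′ (suc (suc n)) ∷ []
    ≡⟨ cong₂ _∷_ (label-< (embed-< (suc-<-M n)))
         (cong₂ _∷_ (label-≥ {A′} {A′} ≤-refl) (cong₂ _∷_ (label-< (≤-<-trans z≤n n+2<A′)) (cong (_∷ []) (label-< n+2<A′)))) ⟩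
      a ∷ b ∷ a ∷ a ∷ []
    ∎ where open ≡-Reasoning

  ξ-rotate : iterate Ψ′ (embed (suc n)) 3 ≡ suc (suc n)
  ξ-rotate with to-A′ ∷ to-0 ∷ to-n+2 ∷ _ ← ξ-path = trans (cong (λ u → Ψ′ (Ψ′ u)) to-A′) (trans (cong Ψ′ to-0) to-n+2)

length-a∷fibStem : ∀ n → length (a ∷ fibStem n) ≡ M n
length-a∷fibStem n = cong (_∸ 1) (begin
    suc (suc (length (fibStem n)))
  ≡⟨ sym (trans (length-++ (fibStem n)) (+-comm (length (fibStem n)) 2)) ⟩
    length (fibStem n ++ a ∷ b ∷ [])
  ≡⟨ cong length (sym (fibWord-even n)) ⟩
    length (fibWord (4 + double n))
  ≡⟨ length-fibWord (4 + double n) ⟩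
    Fᵉ (suc (suc n))
  ∎) where open ≡-Reasoning

Cycle : ℕ → Set
Cycle n = ExactPeriod (Ψ n) (M n) (suc n) × itinerary (Ψ n) (A n) (M n) (suc n) ≡ a ∷ fibStem n

cycle-zero : Cycle 0
cycle-zero = (refl , no-return) , refl
  where
  no-return : ∀ t → 0 < t → t < 4 → iterate (Ψ 0) 1 t ≢ 1
  no-return 1 _ _ ()
  no-return 2 _ _ ()
  no-return 3 _ _ ()
  no-return (suc (suc (suc (suc _)))) _ (s≤s (s≤s (s≤s (s≤s ()))))

module CycleStep (n : ℕ) (cycleₙ : Cycle n) where
  open Step n

  open Refinement (Level.ψ-closed n) (suc-<-M n) (proj₁ cycleₙ) Ψ′ embed len (λ y<M → path-iterate (path y<M)) avoid embed-injective

  m : ℕ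
  m = M n ∸ 1
  1+m≡M : suc m ≡ M n
  1+m≡M = m+[n∸m]≡n (0<M n)

  stem : itinerary (Ψ n) (A n) m (Ψ n (suc n)) ≡ fibStem n
  stem = cong (drop 1) (trans (cong (λ k → itinerary (Ψ n) (A n) k (suc n)) 1+m≡M) (proj₂ cycleₙ))

  refined : itinerary Ψ′ A′ (span (M n) (suc n)) (embed (suc n)) ≡ a ∷ b ∷ a ∷ a ∷ concatMap φ² (fibStem n)
  refined = trans (itinerary-refined φ² (A n) A′ segment m 1+m≡M)
              (cong₂ _++_ ξ-segment (cong (concatMap φ²) stem))

  span≡M′ : span (M n) (suc n) ≡ M (suc n)
  span≡M′ = begin
      span (M n) (suc n)
    ≡⟨ sym (length-itinerary Ψ′ A′ _ (embed (suc n))) ⟩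
      length (itinerary Ψ′ A′ (span (M n) (suc n)) (embed (suc n)))
    ≡⟨ cong length refined ⟩
      4 + length (concatMap φ² (fibStem n))
    ≡⟨ cong suc (sym (trans (length-++ (concatMap φ² (fibStem n))) (+-comm _ 3))) ⟩
      length (a ∷ fibStem (suc n))
    ≡⟨ length-a∷fibStem (suc n) ⟩
      M (suc n)
    ∎ where open ≡-Reasoning

  embed-ξ<M′ : embed (suc n) < M (suc n)
  embed-ξ<M′ = <-≤-trans (embed-< (suc-<-M n)) (A≤M (suc n))

  exactPeriod-embed : ExactPeriod Ψ′ (M (suc n)) (embed (suc n))
  exactPeriod-embed = subst (λ k → ExactPeriod Ψ′ k (embed (suc n))) span≡M′ exactPeriod-refined

  exactPeriod-n+2 : ExactPeriod Ψ′ (M (suc n)) (suc (suc n))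
  exactPeriod-n+2 = subst (ExactPeriod Ψ′ (M (suc n))) ξ-rotate
    (exactPeriod-iterate (Level.ψ-closed (suc n)) (Level.ψ-injective (suc n)) embed-ξ<M′ exactPeriod-embed 3)

  itinerary-n+2 : itinerary Ψ′ A′ (M (suc n)) (suc (suc n)) ≡ a ∷ fibStem (suc n)
  itinerary-n+2 = begin
      itinerary Ψ′ A′ (M (suc n)) (suc (suc n))
    ≡⟨ cong (itinerary Ψ′ A′ (M (suc n))) (sym ξ-rotate) ⟩
      itinerary Ψ′ A′ (M (suc n)) (iterate Ψ′ (embed (suc n)) 3)
    ≡⟨ itinerary-rotate Ψ′ A′ (M (suc n)) (embed (suc n)) 3 (proj₁ exactPeriod-embed) 3≤M′ ⟩
      conj (itinerary Ψ′ A′ (M (suc n)) (embed (suc n))) 3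
    ≡⟨ cong (λ k → conj (itinerary Ψ′ A′ k (embed (suc n))) 3) (sym span≡M′) ⟩
      conj (itinerary Ψ′ A′ (span (M n) (suc n)) (embed (suc n))) 3
    ≡⟨ cong (λ w → conj w 3) refined ⟩
      a ∷ fibStem (suc n)
    ∎
    where
    open ≡-Reasoning
    3≤M′ : 3 ≤ M (suc n)
    3≤M′ = ≤-trans (s≤s (s≤s (s≤s z≤n))) (≤-trans n+2<A′ (A≤M (suc n)))

  cycle-suc : Cycle (suc n)
  cycle-suc = exactPeriod-n+2 , itinerary-n+2

cycle : ∀ n → Cycle n
cycle zero = cycle-zero
cycle (suc n) = CycleStep.cycle-suc n (cycle n)

bwt-fibStem : ∀ n → BWT (fibStem n ++ a ∷ []) ≡ fibBWT n
bwt-fibStem n = begin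
    BWT (conj (a ∷ fibStem n) 1)
  ≡⟨ cong (λ w → BWT (conj w 1)) (sym itinerary≡) ⟩
    BWT (conj (itinerary (Ψ n) (A n) (M n) (suc n)) 1)
  ≡⟨ cong BWT (sym (itinerary-rotate (Ψ n) (A n) (M n) (suc n) 1 (proj₁ period) (0<M n))) ⟩
    BWT (itinerary (Ψ n) (A n) (M n) (Ψ n (suc n)))
  ≡⟨ Level.bwt-itinerary n (Level.ψ-closed n (suc-<-M n))
       (exactPeriod-iterate (Level.ψ-closed n) (Level.ψ-injective n) (suc-<-M n) period 1) ⟩
    fibBWT n
  ∎
  where
  open ≡-Reasoning
  period : ExactPeriod (Ψ n) (M n) (suc n)
  period = proj₁ (cycle n)
  itinerary≡ : itinerary (Ψ n) (A n) (M n) (suc n) ≡ a ∷ fibStem n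
  itinerary≡ = proj₂ (cycle n)

Mid≡concat : ∀ n → Mid n ≡ concat (applyUpTo (λ t → a ∷ (b ^ʷ Fᵒ (n ∸ suc t))) n)
Mid≡concat zero = refl
Mid≡concat (suc n) = cong (λ w → a ∷ (b ^ʷ Fᵒ n) ++ w) (Mid≡concat n)

middle≡Mid : ∀ n → middle (2 + n) ≡ Mid n
middle≡Mid n = begin
    concatMap f (map (3 +_) (upTo n))
  ≡⟨ concatMap-map f (3 +_) (upTo n) ⟩
    concatMap (f ∘ (3 +_)) (upTo n)
  ≡⟨ concatMap-cong (λ t → cong (λ i → a ∷ (b ^ʷ F i)) (exponent t)) (upTo n) ⟩
    concat (map (λ t → a ∷ (b ^ʷ Fᵒ (n ∸ suc t))) (upTo n))
  ≡⟨ cong concat (map-upTo _ n) ⟩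
    concat (applyUpTo (λ t → a ∷ (b ^ʷ Fᵒ (n ∸ suc t))) n)
  ≡⟨ sym (Mid≡concat n) ⟩
    Mid n
  ∎
  where
  open ≡-Reasoning
  f : ℕ → Word
  f i = a ∷ (b ^ʷ F ((2 * (2 + n) ∸ 2 * i) + 1))
  exponent : ∀ t → (2 * (2 + n) ∸ 2 * (3 + t)) + 1 ≡ suc (double (n ∸ suc t))
  exponent t = trans (+-comm _ 1) (cong suc (trans (sym (*-distribˡ-∸ 2 (2 + n) (3 + t))) (sym (double≡2* (n ∸ suc t)))))

expectedBWT≡fibBWT : ∀ n → expectedBWT (2 + n) ≡ fibBWT n
expectedBWT≡fibBWT n = begin
    (b ^ʷ suc n) ++ (a ∷ (b ^ʷ (F (2 * (2 + n) ∸ 3) ∸ suc n))) ++ middle (2 + n) ++ (a ^ʷ (F (2 * (2 + n) ∸ 1) ∸ suc n))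
  ≡⟨ cong (λ d → (b ^ʷ suc n) ++ (a ∷ (b ^ʷ (F (d ∸ 3) ∸ suc n))) ++ middle (2 + n) ++ (a ^ʷ (F (d ∸ 1) ∸ suc n)))
          (sym (double≡2* (2 + n))) ⟩
    (b ^ʷ suc n) ++ (a ∷ (b ^ʷ gap n)) ++ middle (2 + n) ++ (a ^ʷ trail n)
  ≡⟨ cong (λ w → (b ^ʷ suc n) ++ (a ∷ (b ^ʷ gap n)) ++ w ++ (a ^ʷ trail n)) (middle≡Mid n) ⟩
    fibBWT n
  ∎ where open ≡-Reasoning

runs-b^-a : ∀ {m} → 0 < m → ∀ w → runs ((b ^ʷ m) ++ a ∷ w) ≡ suc (runs (a ∷ w))
runs-b^-a {suc zero} _ w = refl
runs-b^-a {suc (suc m)} _ w = runs-b^-a {suc m} (s≤s z≤n) w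

runs-a-b^-a : ∀ {m} → 0 < m → ∀ w → runs (a ∷ (b ^ʷ m) ++ a ∷ w) ≡ suc (suc (runs (a ∷ w)))
runs-a-b^-a {suc m} 0<m w = cong suc (runs-b^-a 0<m w)

runs-a^ : ∀ {m} → 0 < m → runs (a ^ʷ m) ≡ 1
runs-a^ {suc zero} _ = refl
runs-a^ {suc (suc m)} _ = runs-a^ {suc m} (s≤s z≤n)

Mid++a^-head : ∀ n {m} → 0 < m → ∃ λ w → Mid n ++ (a ^ʷ m) ≡ a ∷ w
Mid++a^-head zero {suc m} _ = _ , refl
Mid++a^-head (suc n) _ = _ , refl

runs-Mid++a^ : ∀ n {m} → 0 < m → runs (Mid n ++ (a ^ʷ m)) ≡ suc (double n)
runs-Mid++a^ zero 0<m = runs-a^ 0<m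
runs-Mid++a^ (suc n) {m} 0<m with w , Mid++a^≡ ← Mid++a^-head n 0<m = begin
    runs (a ∷ ((b ^ʷ Fᵒ n) ++ Mid n) ++ (a ^ʷ m))
  ≡⟨ cong (λ u → runs (a ∷ u)) (trans (++-assoc (b ^ʷ Fᵒ n) (Mid n) _) (cong ((b ^ʷ Fᵒ n) ++_) Mid++a^≡)) ⟩
    runs (a ∷ (b ^ʷ Fᵒ n) ++ a ∷ w)
  ≡⟨ runs-a-b^-a (F-positive (suc (double n))) w ⟩
    suc (suc (runs (a ∷ w)))
  ≡⟨ cong (λ u → suc (suc (runs u))) (sym Mid++a^≡) ⟩
    suc (suc (runs (Mid n ++ (a ^ʷ m))))
  ≡⟨ cong (λ r → suc (suc r)) (runs-Mid++a^ n 0<m) ⟩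
    suc (double (suc n))
  ∎ where open ≡-Reasoning

runs-fibBWT : ∀ n → runs (fibBWT (suc n)) ≡ double (3 + n)
runs-fibBWT n with w , Mid++a^≡ ← Mid++a^-head (suc n) (0<trail (suc n)) = begin
    runs ((b ^ʷ suc (suc n)) ++ a ∷ (b ^ʷ gap (suc n)) ++ Mid (suc n) ++ (a ^ʷ trail (suc n)))
  ≡⟨ runs-b^-a {suc (suc n)} (s≤s z≤n) ((b ^ʷ gap (suc n)) ++ Mid (suc n) ++ (a ^ʷ trail (suc n))) ⟩
    suc (runs (a ∷ (b ^ʷ gap (suc n)) ++ Mid (suc n) ++ (a ^ʷ trail (suc n))))
  ≡⟨ cong (λ u → suc (runs (a ∷ (b ^ʷ gap (suc n)) ++ u))) Mid++a^≡ ⟩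
    suc (runs (a ∷ (b ^ʷ gap (suc n)) ++ a ∷ w))
  ≡⟨ cong suc (runs-a-b^-a (0<gap n) w) ⟩
    suc (suc (suc (runs (a ∷ w))))
  ≡⟨ cong (λ u → suc (suc (suc (runs u)))) (sym Mid++a^≡) ⟩
    suc (suc (suc (runs (Mid (suc n) ++ (a ^ʷ trail (suc n))))))
  ≡⟨ cong (λ r → suc (suc (suc r))) (runs-Mid++a^ (suc n) (0<trail (suc n))) ⟩
    double (3 + n)
  ∎ where open ≡-Reasoning

proposition4 : (k : ℕ) → 4 < 2 * k →
    (BWT (hat (fibWord (2 * k))) ≡ expectedBWT k) × (runs (BWT (hat (fibWord (2 * k)))) ≡ 2 * k)
-- The BWT identity holds for k = 2 as well (level 0); 4 < 2 k is needed only for the runs.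
proposition4 zero ()
proposition4 (suc zero) (s≤s (s≤s ()))
proposition4 (suc (suc zero)) (s≤s (s≤s (s≤s (s≤s ()))))
proposition4 (suc (suc (suc n))) _ = bwt≡expected , runs≡
  where
  bwt≡fibBWT : BWT (hat (fibWord (2 * (3 + n)))) ≡ fibBWT (suc n)
  bwt≡fibBWT = trans (cong BWT (hat-fibWord (suc n))) (bwt-fibStem (suc n))
  bwt≡expected : BWT (hat (fibWord (2 * (3 + n)))) ≡ expectedBWT (3 + n)
  bwt≡expected = trans bwt≡fibBWT (sym (expectedBWT≡fibBWT (suc n)))
  runs≡ : runs (BWT (hat (fibWord (2 * (3 + n))))) ≡ 2 * (3 + n)
  runs≡ = trans (cong runs bwt≡fibBWT) (trans (runs-fibBWT n) (double≡2* (3 + n)))
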